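{- Let $\mathscr{S}$ be the set of integer partitions $\lambda=\mu_1+\mu_2+\cdots+\mu_s$ (with $\mu_1\ge\mu_2\ge\cdots\ge\mu_s\ge1$, the empty partition included) such that $\mu_i-\mu_{i+1}\ge 3$ for all $i$, with strict inequality $\mu_i-\mu_{i+1}>3$ whenever $3\mid\mu_i$. For a set $T$ of positive integers let $\mathscr{S}_T$ be the set of partitions in $\mathscr{S}$ whose smallest part does not belong to $T$ (the empty partition is included). Then, as formal power series, \begin{align*} \sum_{\lambda\in\mathscr{S}}x^{\sharp(\lambda)}y^{\sharp_{0,2}(\lambda)}q^{|\lambda|}&=\sum_{n_1,n_2,n_3\ge 0}\frac{(-1)^{n_3}x^{n_1+n_2+2n_3}y^{n_2+n_3}\,q^{4\binom{n_1}{2}+4\binom{n_2}{2}+18\binom{n_3}{2}+2n_1n_2+6n_2n_3+6n_3n_1+ n_1+2 n_2+9n_3}}{(q^2;q^2)_{n_1}(q^2;q^2)_{n_2}(q^6;q^6)_{n_3}},\\ \sum_{\lambda\in\mathscr{S}_{\{1\}}}x^{\sharp(\lambda)}y^{\sharp_{0,2}(\lambda)}q^{|\lambda|}&=\sum_{n_1,n_2,n_3\ge 0}\frac{(-1)^{n_3}x^{n_1+n_2+2n_3}y^{n_2+n_3}\,q^{4\binom{n_1}{2}+4\binom{n_2}{2}+18\binom{n_3}{2}+2n_1n_2+6n_2n_3+6n_3n_1+ 3n_1+2 n_2+9n_3}}{(q^2;q^2)_{n_1}(q^2;q^2)_{n_2}(q^6;q^6)_{n_3}},\\ \sum_{\lambda\in\mathscr{S}_{\{1,2,3\}}}x^{\sharp(\lambda)}y^{\sharp_{0,2}(\lambda)}q^{|\lambda|}&=\sum_{n_1,n_2,n_3\ge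 0}\frac{(-1)^{n_3}x^{n_1+n_2+2n_3}y^{n_2+n_3}\,q^{4\binom{n_1}{2}+4\binom{n_2}{2}+18\binom{n_3}{2}+2n_1n_2+6n_2n_3+6n_3n_1+ 5n_1+4 n_2+15n_3}}{(q^2;q^2)_{n_1}(q^2;q^2)_{n_2}(q^6;q^6)_{n_3}}. \end{align*}
   Context: For a partition $\lambda$, $|\lambda|$ is the sum of its parts, $\sharp(\lambda)$ the number of parts, and $\sharp_{a,M}(\lambda)$ the number of parts congruent to $a$ modulo $M$ (so $\sharp_{0,2}(\lambda)$ is the number of even parts). The $q$-Pochhammer symbol is $(A;q)_n=\prod_{k=0}^{n-1}(1-Aq^k)$. -}

module Defs where

open import Data.Bool using (Bool; true; false; if_then_else_; _∨_)
open import Data.Nat using (ℕ; zero; suc; _+_; _*_; _∸_; _≤_; _%_; _≡ᵇ_)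
open import Data.Nat.Divisibility using (_∣?_)
open import Data.Nat.Combinatorics using (_C_)
open import Data.Integer as ℤ using (ℤ; +_; 0ℤ; 1ℤ)
open import Data.Nat.ListAction using (sum)
open import Data.List using (List; []; _∷_; length; filter; last; upTo; foldr; map)
open import Data.Maybe using (Maybe; just; nothing; maybe)
open import Data.Product using (Σ; _×_)
open import Data.Unit using (⊤)
open import Relation.Nullary.Decidable using (does)
open import Relation.Binary.PropositionalEquality using (_≡_)
open import Data.Nat using (_≟_)

-- minimal gap required after a part m: 4 if 3 ∣ m (strict > 3), else 3
gap : ℕ → ℕ
gap m = if (m % 3) ≡ᵇ 0 then 4 else 3

data IsS : List ℕ → Set where
  nil  : IsS []
  one  : ∀ {m} → 1 ≤ m → IsS (m ∷ [])
  cons : ∀ {m n l} → gap m + n ≤ m → IsS (n ∷ l) → IsS (m ∷ n ∷ l)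

_∈ᵇ_ : ℕ → List ℕ → Bool
m ∈ᵇ []      = false
m ∈ᵇ (t ∷ T) = (m ≡ᵇ t) ∨ (m ∈ᵇ T)

-- the smallest part (the last one) does not belong to T; empty partition allowed
SmallestNotIn : List ℕ → List ℕ → Set
SmallestNotIn T l = maybe (λ m → (m ∈ᵇ T) ≡ false) ⊤ (last l)

-- ♯_{0,2}(λ): number of even parts
numEven : List ℕ → ℕ
numEven l = length (filter (λ m → (m % 2) ≟ 0) l)

SPart : List ℕ → ℕ → ℕ → ℕ → Set
SPart T a b N = Σ (List ℕ) λ l →
  IsS l × SmallestNotIn T l × length l ≡ a × numEven l ≡ b × sum l ≡ N

FPS : Set
FPS = ℕ → ℤ

Σ≤ : ℕ → (ℕ → ℤ) → ℤ
Σ≤ n f = foldr ℤ._+_ 0ℤ (map f (upTo (suc n)))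

_⊕_ : FPS → FPS → FPS
(f ⊕ g) n = f n ℤ.+ g n

_⊛_ : FPS → FPS → FPS
(f ⊛ g) n = Σ≤ n (λ i → f i ℤ.* g (n ∸ i))

oneS : FPS
oneS n = if n ≡ᵇ 0 then 1ℤ else 0ℤ

zeroS : FPS
zeroS _ = 0ℤ

mono : ℤ → ℕ → FPS
mono c e n = if n ≡ᵇ e then c else 0ℤ

-- 1/(1 - q^k) = Σ_{m≥0} q^{km}   (k ≥ 1)
geo : ℕ → FPS
geo k n = if does (k ∣? n) then 1ℤ else 0ℤ

invPoch : ℕ → ℕ → FPS
invPoch d zero    = oneS
invPoch d (suc n) = invPoch d n ⊛ geo (d * suc n)

negOnePow : ℕ → ℤ
negOnePow zero    = 1ℤ
negOnePow (suc n) = ℤ.- negOnePow n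

qExp : ℕ → ℕ → ℕ → ℕ → ℕ → ℕ → ℕ
qExp c₁ c₂ c₃ n₁ n₂ n₃ =
  4 * (n₁ C 2) + 4 * (n₂ C 2) + 18 * (n₃ C 2)
  + 2 * n₁ * n₂ + 6 * n₂ * n₃ + 6 * n₃ * n₁
  + c₁ * n₁ + c₂ * n₂ + c₃ * n₃

summand : ℕ → ℕ → ℕ → ℕ → ℕ → ℕ → FPS
summand c₁ c₂ c₃ n₁ n₂ n₃ =
  ((mono (negOnePow n₃) (qExp c₁ c₂ c₃ n₁ n₂ n₃) ⊛ invPoch 2 n₁) ⊛ invPoch 2 n₂)
    ⊛ invPoch 6 n₃

ΣS≤ : ℕ → (ℕ → FPS) → FPS
ΣS≤ n F = foldr _⊕_ zeroS (map F (upTo (suc n)))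

-- coefficient of x^a y^b of the right-hand side (a q-series):
-- sum of summands over n₁,n₂,n₃ with n₁+n₂+2n₃ = a and n₂+n₃ = b
-- (all such n_i are ≤ a, so the range 0..a is exhaustive)
rhsXY : ℕ → ℕ → ℕ → ℕ → ℕ → FPS
rhsXY c₁ c₂ c₃ a b =
  ΣS≤ a λ n₁ → ΣS≤ a λ n₂ → ΣS≤ a λ n₃ →
    if ((n₁ + n₂ + 2 * n₃) ≡ᵇ a) Data.Bool.∧ ((n₂ + n₃) ≡ᵇ b)
    then summand c₁ c₂ c₃ n₁ n₂ n₃ else zeroS

module Submission where

-- Let F_m be the generating function in x, y, q of the partitions in 𝒮 with all parts ≥ m,
-- listed in increasing order. Splitting off the smallest part, and adding 6 to every part, give
--   F_m = F_(m+1) + x y^[m even] q^m F_(m + gap m)   and   F_(m+6)(x,y,q) = F_m(x q^6,y,q),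
-- which determine the coefficients of F_1, …, F_6 by induction on the weight.
-- Let G_c be the triple sum of the theorem with linear exponent c₁n₁ + c₂n₂ + c₃n₃. Expanding
-- 1/(q^d;q^d)_(n+1) = 1/(q^d;q^d)_n + q^(d(n+1))/(q^d;q^d)_(n+1) in each of its three factors
-- gives three recurrences in c; from them G_(1,2,9), G_(3,2,9), G_(3,4,9), G_(5,4,15),
-- G_(5,6,15), G_(7,6,15) satisfy the same system as F_1, …, F_6, and
-- G_(c+(6,6,12))(x,y,q) = G_c(x q^6,y,q).

module FiniteSums where

  open import Data.Nat as ℕ using (ℕ; zero; suc; _<_; _≤_; z≤n; s≤s)
  open import Data.Nat.Properties as ℕP using ()
  open import Data.Integer using (ℤ; 0ℤ; _+_; _*_; -_)
  open import Data.Integer.Properties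
  open import Algebra.Properties.CommutativeSemigroup +-commutativeSemigroup using (interchange)
  open import Function using (_∘_)
  open import Relation.Binary.PropositionalEquality
  open import Relation.Nullary using (¬_; yes; no)

  Σ< : ℕ → (ℕ → ℤ) → ℤ
  Σ< zero    f = 0ℤ
  Σ< (suc n) f = f 0 + Σ< n (f ∘ suc)

  Σ<-cong : ∀ n {f g : ℕ → ℤ} → (∀ i → i < n → f i ≡ g i) → Σ< n f ≡ Σ< n g
  Σ<-cong zero    eq = refl
  Σ<-cong (suc n) eq = cong₂ _+_ (eq 0 (s≤s z≤n)) (Σ<-cong n (λ i i<n → eq (suc i) (s≤s i<n)))

  Σ<-zero : ∀ n {f : ℕ → ℤ} → (∀ i → i < n → f i ≡ 0ℤ) → Σ< n f ≡ 0ℤ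
  Σ<-zero zero    eq = refl
  Σ<-zero (suc n) eq = cong₂ _+_ (eq 0 (s≤s z≤n)) (Σ<-zero n (λ i i<n → eq (suc i) (s≤s i<n)))

  Σ<-distrib-+ : ∀ n (f g : ℕ → ℤ) → Σ< n (λ i → f i + g i) ≡ Σ< n f + Σ< n g
  Σ<-distrib-+ zero    f g = refl
  Σ<-distrib-+ (suc n) f g = trans (cong (f 0 + g 0 +_) (Σ<-distrib-+ n (f ∘ suc) (g ∘ suc)))
                                   (interchange (f 0) (g 0) _ _)

  Σ<-distribˡ-* : ∀ n c (f : ℕ → ℤ) → Σ< n (λ i → c * f i) ≡ c * Σ< n f
  Σ<-distribˡ-* zero    c f = sym (*-zeroʳ c)
  Σ<-distribˡ-* (suc n) c f = trans (cong (c * f 0 +_) (Σ<-distribˡ-* n c (f ∘ suc)))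
                                    (sym (*-distribˡ-+ c (f 0) _))

  Σ<-negate : ∀ n (f : ℕ → ℤ) → Σ< n (λ i → - f i) ≡ - Σ< n f
  Σ<-negate zero    f = refl
  Σ<-negate (suc n) f = trans (cong (- f 0 +_) (Σ<-negate n (f ∘ suc))) (sym (neg-distrib-+ (f 0) _))

  Σ<-last : ∀ n (f : ℕ → ℤ) → Σ< (suc n) f ≡ Σ< n f + f n
  Σ<-last zero    f = +-comm (f 0) 0ℤ
  Σ<-last (suc n) f = trans (cong (f 0 +_) (Σ<-last n (f ∘ suc))) (sym (+-assoc (f 0) _ _))

  Σ<-comm : ∀ m n (h : ℕ → ℕ → ℤ) → Σ< m (λ i → Σ< n (h i)) ≡ Σ< n (λ j → Σ< m (λ i → h i j))
  Σ<-comm zero    n h = sym (Σ<-zero n (λ _ _ → refl))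
  Σ<-comm (suc m) n h = trans (cong (Σ< n (h 0) +_) (Σ<-comm m n (h ∘ suc)))
                              (sym (Σ<-distrib-+ n (h 0) _))

  Σ<-extend : ∀ m n (f : ℕ → ℤ) → (∀ i → m ≤ i → f i ≡ 0ℤ) → Σ< (m ℕ.+ n) f ≡ Σ< m f
  Σ<-extend zero    n f vanish = Σ<-zero n (λ i _ → vanish i z≤n)
  Σ<-extend (suc m) n f vanish =
    cong (f 0 +_) (Σ<-extend m n (f ∘ suc) (λ i m≤i → vanish (suc i) (s≤s m≤i)))

  Σ<-single : ∀ n t (f : ℕ → ℤ) → (∀ i → ¬ i ≡ t → f i ≡ 0ℤ) → (n ≤ t → f t ≡ 0ℤ) →
              Σ< n f ≡ f t
  Σ<-single zero    t f off out = sym (out z≤n)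
  Σ<-single (suc n) t f off out with n ℕ.≟ t
  ... | yes refl = trans (Σ<-last n f)
                     (trans (cong (_+ f n) (Σ<-zero n (λ i i<n → off i (λ { refl → ℕP.<-irrefl refl i<n }))))
                            (+-identityˡ (f n)))
  ... | no n≢t   = trans (Σ<-last n f)
                     (trans (cong₂ _+_ (Σ<-single n t f off (λ n≤t → out (ℕP.≤∧≢⇒< n≤t n≢t))) (off n n≢t))
                            (+-identityʳ _))

module PowerSeries where

  open import Defs
  open import Data.Bool using (if_then_else_)
  open FiniteSums
  open import Data.Nat as ℕ using (ℕ; zero; suc; _∸_; _<_; _≤_; s≤s)
  open import Data.Nat.Properties as ℕP using ()
  open import Data.Empty using (⊥-elim)
  open import Data.Nat.Divisibility using (_∣?_; _∣0; ∣-refl; ∣⇒≤; ∣m∣n⇒∣m+n; ∣m+n∣m⇒∣n)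
  open import Data.Integer using (ℤ; 0ℤ; _+_; _*_; -_)
  open import Data.Integer.Properties
  open import Data.Integer.Solver using (module +-*-Solver)
  open +-*-Solver using (solve; _:+_; :-_; _:=_)
  open import Algebra.Properties.CommutativeSemigroup +-commutativeSemigroup using (xy∙z≈xz∙y)
  open import Data.List using (map; applyUpTo)
  open import Function using (_∘_; id)
  open import Relation.Binary.PropositionalEquality
  open import Relation.Nullary using (Dec; yes; no; does; ¬_)
  open import Relation.Nullary.Decidable using (dec-true; dec-false)
  import Relation.Binary.Reasoning.Setoid as SetoidReasoning
  open import Relation.Binary.Bundles using (Setoid)

  module ≗-Reasoning = SetoidReasoning (ℕ →-setoid ℤ)
  open Setoid (ℕ →-setoid ℤ) public using () renaming (refl to ≗-refl; sym to ≗-sym; trans to ≗-trans)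

  shift : ℕ → FPS → FPS
  shift zero    f         = f
  shift (suc k) f zero    = 0ℤ
  shift (suc k) f (suc n) = shift k f n

  scale : ℤ → FPS → FPS
  scale c f n = c * f n

  negate : FPS → FPS
  negate f n = - f n

  ⊕-cong : ∀ {f f′ g g′} → f ≗ f′ → g ≗ g′ → (f ⊕ g) ≗ (f′ ⊕ g′)
  ⊕-cong f≗f′ g≗g′ n = cong₂ _+_ (f≗f′ n) (g≗g′ n)

  ⊕-congˡ : ∀ {f f′} g → f ≗ f′ → (f ⊕ g) ≗ (f′ ⊕ g)
  ⊕-congˡ g f≗f′ n = cong (_+ g n) (f≗f′ n)

  ⊕-congʳ : ∀ f {g g′} → g ≗ g′ → (f ⊕ g) ≗ (f ⊕ g′)
  ⊕-congʳ f g≗g′ n = cong (f n +_) (g≗g′ n)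

  ⊕-assoc : ∀ f g h → ((f ⊕ g) ⊕ h) ≗ (f ⊕ (g ⊕ h))
  ⊕-assoc f g h n = +-assoc (f n) (g n) (h n)

  ⊕-swapʳ : ∀ f g h → ((f ⊕ g) ⊕ h) ≗ ((f ⊕ h) ⊕ g)
  ⊕-swapʳ f g h n = xy∙z≈xz∙y (f n) (g n) (h n)

  ⊕-identityʳ : ∀ f → (f ⊕ zeroS) ≗ f
  ⊕-identityʳ f n = +-identityʳ (f n)

  ⊕-comm : ∀ f g → (f ⊕ g) ≗ (g ⊕ f)
  ⊕-comm f g n = +-comm (f n) (g n)

  negate-cong : ∀ {f g} → f ≗ g → negate f ≗ negate g
  negate-cong f≗g n = cong -_ (f≗g n)

  scale-cong : ∀ c {f g} → f ≗ g → scale c f ≗ scale c g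
  scale-cong c f≗g n = cong (c *_) (f≗g n)

  scale-distrib-⊕ : ∀ c f g → scale c (f ⊕ g) ≗ (scale c f ⊕ scale c g)
  scale-distrib-⊕ c f g n = *-distribˡ-+ c (f n) (g n)

  shift-cong : ∀ k {f g} → f ≗ g → shift k f ≗ shift k g
  shift-cong zero    f≗g n       = f≗g n
  shift-cong (suc k) f≗g zero    = refl
  shift-cong (suc k) f≗g (suc n) = shift-cong k f≗g n

  shift-+ : ∀ k m f → shift k f (k ℕ.+ m) ≡ f m
  shift-+ zero    m f = refl
  shift-+ (suc k) m f = shift-+ k m f

  shift-≤ : ∀ k f {n} → k ≤ n → shift k f n ≡ f (n ∸ k)
  shift-≤ k f k≤n = trans (cong (shift k f) (sym (ℕP.m+[n∸m]≡n k≤n))) (shift-+ k _ f)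

  shift-< : ∀ k f {n} → n < k → shift k f n ≡ 0ℤ
  shift-< (suc k) f {zero}  _         = refl
  shift-< (suc k) f {suc n} (s≤s n<k) = shift-< k f n<k

  shift-zeroS : ∀ k → shift k zeroS ≗ zeroS
  shift-zeroS zero    n       = refl
  shift-zeroS (suc k) zero    = refl
  shift-zeroS (suc k) (suc n) = shift-zeroS k n

  ⊕-shift-vanish : ∀ f k {g} → g ≗ zeroS → (f ⊕ shift k g) ≗ f
  ⊕-shift-vanish f k {g} g≗0 n =
    trans (cong (f n +_) (trans (shift-cong k g≗0 n) (shift-zeroS k n))) (+-identityʳ (f n))

  negate-shift-vanish : ∀ f k {g} → g ≗ zeroS → (f ⊕ negate (shift k g)) ≗ f
  negate-shift-vanish f k {g} g≗0 n =
    trans (cong (λ x → f n + - x) (trans (shift-cong k g≗0 n) (shift-zeroS k n))) (+-identityʳ (f n))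

  shift-shift : ∀ k l f → shift k (shift l f) ≗ shift (k ℕ.+ l) f
  shift-shift zero    l f n       = refl
  shift-shift (suc k) l f zero    = refl
  shift-shift (suc k) l f (suc n) = shift-shift k l f n

  shift-distrib-⊕ : ∀ k f g → shift k (f ⊕ g) ≗ (shift k f ⊕ shift k g)
  shift-distrib-⊕ zero    f g n       = refl
  shift-distrib-⊕ (suc k) f g zero    = refl
  shift-distrib-⊕ (suc k) f g (suc n) = shift-distrib-⊕ k f g n

  shift-scale : ∀ k c f → shift k (scale c f) ≗ scale c (shift k f)
  shift-scale zero    c f n       = refl
  shift-scale (suc k) c f zero    = sym (*-zeroʳ c)
  shift-scale (suc k) c f (suc n) = shift-scale k c f n

  shift-negate : ∀ k f → shift k (negate f) ≗ negate (shift k f)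
  shift-negate zero    f n       = refl
  shift-negate (suc k) f zero    = refl
  shift-negate (suc k) f (suc n) = shift-negate k f n

  shift-≡ : ∀ {k l} f → k ≡ l → shift k f ≗ shift l f
  shift-≡ f refl n = refl

  mono≗shift : ∀ c e → mono c e ≗ shift e (mono c 0)
  mono≗shift c zero    n       = refl
  mono≗shift c (suc e) zero    = refl
  mono≗shift c (suc e) (suc n) = mono≗shift c e n

  Σ≤-Σ< : ∀ n f → Σ≤ n f ≡ Σ< (suc n) f
  Σ≤-Σ< n f = go (suc n) id
    where
    go : ∀ m (g : ℕ → ℕ) → Data.List.foldr _+_ 0ℤ (map f (applyUpTo g m)) ≡ Σ< m (f ∘ g)
    go zero    g = refl
    go (suc m) g = cong (f (g 0) +_) (go m (g ∘ suc))

  ΣS≤-Σ< : ∀ n F N → ΣS≤ n F N ≡ Σ< (suc n) (λ i → F i N)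
  ΣS≤-Σ< n F N = go (suc n) id
    where
    go : ∀ m (g : ℕ → ℕ) → Data.List.foldr _⊕_ zeroS (map F (applyUpTo g m)) N ≡ Σ< m (λ i → F (g i) N)
    go zero    g = refl
    go (suc m) g = cong (F (g 0) N +_) (go m (g ∘ suc))

  ⊛-coeff : ∀ f g n → (f ⊛ g) n ≡ Σ< (suc n) (λ i → f i * g (n ∸ i))
  ⊛-coeff f g n = Σ≤-Σ< n (λ i → f i * g (n ∸ i))

  ⊛-cong : ∀ {f f′ g g′} → f ≗ f′ → g ≗ g′ → (f ⊛ g) ≗ (f′ ⊛ g′)
  ⊛-cong {f} {f′} {g} {g′} f≗f′ g≗g′ n =
    trans (⊛-coeff f g n)
      (trans (Σ<-cong (suc n) (λ i _ → cong₂ _*_ (f≗f′ i) (g≗g′ (n ∸ i)))) (sym (⊛-coeff f′ g′ n)))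

  ⊛-congˡ : ∀ {f f′} g → f ≗ f′ → (f ⊛ g) ≗ (f′ ⊛ g)
  ⊛-congˡ g f≗f′ = ⊛-cong {g = g} {g} f≗f′ ≗-refl

  ⊛-congʳ : ∀ f {g g′} → g ≗ g′ → (f ⊛ g) ≗ (f ⊛ g′)
  ⊛-congʳ f g≗g′ = ⊛-cong {f} {f} ≗-refl g≗g′

  ⊛-distribʳ-⊕ : ∀ f g h → ((f ⊕ g) ⊛ h) ≗ ((f ⊛ h) ⊕ (g ⊛ h))
  ⊛-distribʳ-⊕ f g h n =
    trans (⊛-coeff (f ⊕ g) h n)
      (trans (Σ<-cong (suc n) (λ i _ → *-distribʳ-+ (h (n ∸ i)) (f i) (g i)))
        (trans (Σ<-distrib-+ (suc n) (λ i → f i * h (n ∸ i)) (λ i → g i * h (n ∸ i))) (sym (cong₂ _+_ (⊛-coeff f h n) (⊛-coeff g h n)))))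

  ⊛-distribˡ-⊕ : ∀ f g h → (f ⊛ (g ⊕ h)) ≗ ((f ⊛ g) ⊕ (f ⊛ h))
  ⊛-distribˡ-⊕ f g h n =
    trans (⊛-coeff f (g ⊕ h) n)
      (trans (Σ<-cong (suc n) (λ i _ → *-distribˡ-+ (f i) (g (n ∸ i)) (h (n ∸ i))))
        (trans (Σ<-distrib-+ (suc n) (λ i → f i * g (n ∸ i)) (λ i → f i * h (n ∸ i)))
               (sym (cong₂ _+_ (⊛-coeff f g n) (⊛-coeff f h n)))))

  scale-⊛ : ∀ c f g → (scale c f ⊛ g) ≗ scale c (f ⊛ g)
  scale-⊛ c f g n =
    trans (⊛-coeff (scale c f) g n)
      (trans (Σ<-cong (suc n) (λ i _ → *-assoc c (f i) (g (n ∸ i))))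
        (trans (Σ<-distribˡ-* (suc n) c (λ i → f i * g (n ∸ i))) (cong (c *_) (sym (⊛-coeff f g n)))))

  shift-⊛ˡ : ∀ k f g → (shift k f ⊛ g) ≗ shift k (f ⊛ g)
  shift-⊛ˡ zero    f g n       = refl
  shift-⊛ˡ (suc k) f g zero    = +-identityʳ (0ℤ * g 0)
  shift-⊛ˡ (suc k) f g (suc n) =
    trans (⊛-coeff (shift (suc k) f) g (suc n))
      (trans (cong (_+ Σ< (suc n) (λ i → shift k f i * g (n ∸ i))) (*-zeroˡ (g (suc n))))
        (trans (+-identityˡ _) (trans (sym (⊛-coeff (shift k f) g n)) (shift-⊛ˡ k f g n))))

  -- In the coefficient of q^(1+n) the last summand vanishes, and the others
  -- are those of q^n after writing 1+n-i as 1+(n-i).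
  shift-⊛ʳ : ∀ k f g → (f ⊛ shift k g) ≗ shift k (f ⊛ g)
  shift-⊛ʳ zero    f g n       = refl
  shift-⊛ʳ (suc k) f g zero    = trans (+-identityʳ (f 0 * 0ℤ)) (*-zeroʳ (f 0))
  shift-⊛ʳ (suc k) f g (suc n) =
    trans (⊛-coeff f (shift (suc k) g) (suc n))
      (trans (Σ<-last (suc n) (λ i → f i * shift (suc k) g (suc n ∸ i)))
        (trans (cong₂ _+_ (Σ<-cong (suc n) (λ i i≤n → cong (λ m → f i * shift (suc k) g m) (ℕP.+-∸-assoc 1 (ℕP.≤-pred i≤n))))
                          (trans (cong (λ m → f (suc n) * shift (suc k) g m) (ℕP.n∸n≡0 n)) (*-zeroʳ (f (suc n)))))
          (trans (+-identityʳ _) (trans (sym (⊛-coeff f (shift k g) n)) (shift-⊛ʳ k f g n)))))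

  mono0-⊛ : ∀ c g → (mono c 0 ⊛ g) ≗ scale c g
  mono0-⊛ c g n =
    trans (⊛-coeff (mono c 0) g n)
      (trans (cong (c * g n +_) (Σ<-zero n (λ i _ → *-zeroˡ (g (n ∸ suc i))))) (+-identityʳ _))

  ⊛-identityʳ : ∀ f → (f ⊛ oneS) ≗ f
  ⊛-identityʳ f n =
    trans (⊛-coeff f oneS n)
      (trans (Σ<-last n (λ i → f i * oneS (n ∸ i)))
        (trans (cong₂ _+_ (Σ<-zero n (λ i i<n → trans (cong (λ m → f i * oneS m) (ℕP.+-∸-assoc 1 i<n)) (*-zeroʳ (f i))))
                          (cong (λ m → f n * oneS m) (ℕP.n∸n≡0 n)))
          (trans (+-identityˡ _) (*-identityʳ (f n)))))

  geo-+ : ∀ k m → geo k (k ℕ.+ m) ≡ geo k m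
  geo-+ k m with k ∣? m
  ... | yes k∣m rewrite dec-true (k ∣? (k ℕ.+ m)) (∣m∣n⇒∣m+n ∣-refl k∣m) = refl
  ... | no  k∤m rewrite dec-false (k ∣? (k ℕ.+ m)) (λ k∣k+m → k∤m (∣m+n∣m⇒∣n k∣k+m ∣-refl)) = refl

  geo-< : ∀ k n → n < k → geo k n ≡ oneS n
  geo-< k zero    _   rewrite dec-true (k ∣? 0) (k ∣0) = refl
  geo-< k (suc n) n<k rewrite dec-false (k ∣? suc n) (λ k∣n → ℕP.<⇒≱ n<k (∣⇒≤ k∣n)) = refl

  geo-unfold : ∀ k → 0 < k → geo k ≗ (oneS ⊕ shift k (geo k))
  geo-unfold k 0<k n with k ℕ.≤? n
  ... | no  k≰n = trans (geo-< k n (ℕP.≰⇒> k≰n))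
                    (sym (trans (cong (oneS n +_) (shift-< k (geo k) (ℕP.≰⇒> k≰n))) (+-identityʳ _)))
  ... | yes k≤n = begin
      geo k n                ≡⟨ cong (geo k) (ℕP.m+[n∸m]≡n k≤n) ⟨
      geo k (k ℕ.+ (n ∸ k))  ≡⟨ geo-+ k (n ∸ k) ⟩
      geo k (n ∸ k)          ≡⟨ +-identityˡ _ ⟨
      0ℤ + geo k (n ∸ k)     ≡⟨ cong₂ _+_ (oneS-pos (ℕP.<-≤-trans 0<k k≤n)) (shift-≤ k (geo k) k≤n) ⟨
      oneS n + shift k (geo k) n ∎
    where
    open ≡-Reasoning
    oneS-pos : ∀ {n} → 0 < n → oneS n ≡ 0ℤ
    oneS-pos {suc n} _ = refl

  invPoch-unfold : ∀ d n → 0 < d →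
    invPoch d (suc n) ≗ (invPoch d n ⊕ shift (d ℕ.* suc n) (invPoch d (suc n)))
  invPoch-unfold d n 0<d = begin
    I ⊛ geo k                           ≈⟨ ⊛-congʳ I (geo-unfold k (ℕP.<-≤-trans 0<d (ℕP.m≤m*n d (suc n)))) ⟩
    I ⊛ (oneS ⊕ shift k (geo k))        ≈⟨ ⊛-distribˡ-⊕ I oneS (shift k (geo k)) ⟩
    (I ⊛ oneS) ⊕ (I ⊛ shift k (geo k))  ≈⟨ ⊕-cong (⊛-identityʳ I) (shift-⊛ʳ k I (geo k)) ⟩
    I ⊕ shift k (I ⊛ geo k) ∎
    where
    open ≗-Reasoning
    I = invPoch d n
    k = d ℕ.* suc n

  unfold-⊛ˡ : ∀ k g f′ h {f} → f ≗ (g ⊕ shift k f′) → (f ⊛ h) ≗ ((g ⊛ h) ⊕ shift k (f′ ⊛ h))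
  unfold-⊛ˡ k g f′ h {f} f≗ = begin
    f ⊛ h                       ≈⟨ ⊛-congˡ h f≗ ⟩
    (g ⊕ shift k f′) ⊛ h        ≈⟨ ⊛-distribʳ-⊕ g (shift k f′) h ⟩
    (g ⊛ h) ⊕ (shift k f′ ⊛ h)  ≈⟨ ⊕-congʳ (g ⊛ h) (shift-⊛ˡ k f′ h) ⟩
    (g ⊛ h) ⊕ shift k (f′ ⊛ h) ∎
    where open ≗-Reasoning

  unfold-⊛ʳ : ∀ k g f′ h {f} → f ≗ (g ⊕ shift k f′) → (h ⊛ f) ≗ ((h ⊛ g) ⊕ shift k (h ⊛ f′))
  unfold-⊛ʳ k g f′ h {f} f≗ = begin
    h ⊛ f                       ≈⟨ ⊛-congʳ h f≗ ⟩
    h ⊛ (g ⊕ shift k f′)        ≈⟨ ⊛-distribˡ-⊕ h g (shift k f′) ⟩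
    (h ⊛ g) ⊕ (h ⊛ shift k f′)  ≈⟨ ⊕-congʳ (h ⊛ g) (shift-⊛ʳ k h f′) ⟩
    (h ⊛ g) ⊕ shift k (h ⊛ f′) ∎
    where open ≗-Reasoning

  select : ∀ {P : Set} → Dec P → FPS → FPS
  select d f = if does d then f else zeroS

  select-cong : ∀ {P : Set} (d : Dec P) {f g} → (P → f ≗ g) → select d f ≗ select d g
  select-cong (yes p) f≗g = f≗g p
  select-cong (no _)  f≗g = ≗-refl

  select-yes : ∀ {P : Set} (d : Dec P) {f} → P → select d f ≗ f
  select-yes (yes _) p = ≗-refl
  select-yes (no ¬p) p = ⊥-elim (¬p p)

  select-no : ∀ {P : Set} (d : Dec P) {f} → ¬ P → select d f ≗ zeroS
  select-no (yes p) ¬p = ⊥-elim (¬p p)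
  select-no (no _)  ¬p = ≗-refl

  ΣS : ℕ → (ℕ → FPS) → FPS
  ΣS m F n = Σ< m (λ k → F k n)

  ΣS-cong : ∀ m {F G : ℕ → FPS} → (∀ k → k < m → F k ≗ G k) → ΣS m F ≗ ΣS m G
  ΣS-cong m F≗G n = Σ<-cong m (λ k k<m → F≗G k k<m n)

  ΣS-distrib-⊕ : ∀ m F G → ΣS m (λ k → F k ⊕ G k) ≗ (ΣS m F ⊕ ΣS m G)
  ΣS-distrib-⊕ m F G n = Σ<-distrib-+ m (λ k → F k n) (λ k → G k n)

  shift-ΣS : ∀ e m F → shift e (ΣS m F) ≗ ΣS m (λ k → shift e (F k))
  shift-ΣS zero    m F n       = refl
  shift-ΣS (suc e) m F zero    = sym (Σ<-zero m (λ _ _ → refl))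
  shift-ΣS (suc e) m F (suc n) = shift-ΣS e m F n

  negate-ΣS : ∀ m F → negate (ΣS m F) ≗ ΣS m (λ k → negate (F k))
  negate-ΣS m F n = sym (Σ<-negate m (λ k → F k n))

  ΣS-last : ∀ m F → ΣS (suc m) F ≗ (ΣS m F ⊕ F m)
  ΣS-last m F n = Σ<-last m (λ k → F k n)

  negate-shift-cancel : ∀ A p q k e g → k ℕ.+ g ≡ e →
    ((A ⊕ negate (shift e p)) ⊕ shift k (q ⊕ shift g p)) ≗ (A ⊕ shift k q)
  negate-shift-cancel A p q k e g k+g≡e n =
    trans (cong (A n + - shift e p n +_) (expand n))
          (solve 3 (λ A P Q → A :+ :- P :+ (Q :+ P) := A :+ Q) refl (A n) (shift e p n) (shift k q n))
    where
    expand : shift k (q ⊕ shift g p) ≗ (shift k q ⊕ shift e p)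
    expand = ≗-trans (shift-distrib-⊕ k q (shift g p))
                     (⊕-congʳ (shift k q) (≗-trans (shift-shift k g p) (shift-≡ p k+g≡e)))

module BivariateSeries where

  open import Defs
  open PowerSeries
  open import Data.Nat as ℕ using (ℕ; zero; suc; _∸_; _<_; _≤_; s≤s; _+_)
  open import Data.Nat.Properties as ℕP using ()
  open import Relation.Binary.PropositionalEquality

  -- F stands for the series Σ F a b x^a y^b in x, y with coefficients in FPS.
  XYSeries : Set
  XYSeries = ℕ → ℕ → FPS

  timesXY : ℕ → ℕ → XYSeries → XYSeries
  timesXY zero    zero    F a       b       = F a b
  timesXY (suc i) j       F zero    b       = zeroS
  timesXY (suc i) j       F (suc a) b       = timesXY i j F a b
  timesXY zero    (suc j) F a       zero    = zeroS
  timesXY zero    (suc j) F a       (suc b) = timesXY zero j F a b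

  timesXY-map : ∀ (φ : FPS → FPS) → φ zeroS ≗ zeroS → ∀ i j F a b →
    timesXY i j (λ a b → φ (F a b)) a b ≗ φ (timesXY i j F a b)
  timesXY-map φ φ0 zero    zero    F a       b       = ≗-refl
  timesXY-map φ φ0 (suc i) j       F zero    b       = ≗-sym φ0
  timesXY-map φ φ0 (suc i) j       F (suc a) b       = timesXY-map φ φ0 i j F a b
  timesXY-map φ φ0 zero    (suc j) F a       zero    = ≗-sym φ0
  timesXY-map φ φ0 zero    (suc j) F a       (suc b) = timesXY-map φ φ0 zero j F a b

  timesXY-⊕ : ∀ i j F G a b →
    timesXY i j (λ a b → F a b ⊕ G a b) a b ≗ (timesXY i j F a b ⊕ timesXY i j G a b)
  timesXY-⊕ zero    zero    F G a       b       = ≗-refl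
  timesXY-⊕ (suc i) j       F G zero    b       = ≗-refl
  timesXY-⊕ (suc i) j       F G (suc a) b       = timesXY-⊕ i j F G a b
  timesXY-⊕ zero    (suc j) F G a       zero    = ≗-refl
  timesXY-⊕ zero    (suc j) F G a       (suc b) = timesXY-⊕ zero j F G a b

  timesXY-cong< : ∀ i j {F G : XYSeries} a b → (∀ a′ → a′ < a → ∀ b′ → F a′ b′ ≗ G a′ b′) →
    timesXY (suc i) j F a b ≗ timesXY (suc i) j G a b
  timesXY-cong< i       j       zero    b       F≗G = ≗-refl
  timesXY-cong< zero    zero    (suc a) b       F≗G = F≗G a ℕP.≤-refl b
  timesXY-cong< (suc i) j       (suc a) b       F≗G = timesXY-cong< i j a b (λ a′ a′<a → F≗G a′ (ℕP.m≤n⇒m≤1+n a′<a))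
  timesXY-cong< zero    (suc j) (suc a) zero    F≗G = ≗-refl
  timesXY-cong< zero    (suc j) (suc a) (suc b) F≗G = timesXY-cong< zero j (suc a) b F≗G

  timesXY-y0 : ∀ i j F a → timesXY i (suc j) F a 0 ≗ zeroS
  timesXY-y0 zero    j F a       = ≗-refl
  timesXY-y0 (suc i) j F zero    = ≗-refl
  timesXY-y0 (suc i) j F (suc a) = timesXY-y0 i j F a

  timesXY-ysuc : ∀ i j F a b → timesXY i (suc j) F a (suc b) ≗ timesXY i j F a b
  timesXY-ysuc zero    j F a       b = ≗-refl
  timesXY-ysuc (suc i) j F zero    b = ≗-refl
  timesXY-ysuc (suc i) j F (suc a) b = timesXY-ysuc i j F a b

  timesXY-timesXY : ∀ i j k l F a b → timesXY i j (timesXY k l F) a b ≗ timesXY (i + k) (j + l) F a b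
  timesXY-timesXY zero    zero    k l F a       b       = ≗-refl
  timesXY-timesXY (suc i) j       k l F zero    b       = ≗-refl
  timesXY-timesXY (suc i) j       k l F (suc a) b       = timesXY-timesXY i j k l F a b
  timesXY-timesXY zero    (suc j) k l F a       zero    = ≗-sym (timesXY-y0 k (j + l) F a)
  timesXY-timesXY zero    (suc j) k l F a       (suc b) =
    ≗-trans (timesXY-timesXY zero j k l F a b) (≗-sym (timesXY-ysuc k (j + l) F a b))

  timesXY-recurrence : ∀ (φ : FPS → FPS) → φ zeroS ≗ zeroS → (∀ {f g} → f ≗ g → φ f ≗ φ g) →
    ∀ i j k l {F G H : XYSeries} a b →
    (∀ a′ → a′ < a → ∀ b′ → F a′ b′ ≗ (G a′ b′ ⊕ φ (timesXY k l H a′ b′))) →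
    timesXY (suc i) j F a b ≗ (timesXY (suc i) j G a b ⊕ φ (timesXY (suc i + k) (j + l) H a b))
  timesXY-recurrence φ φ0 φ-cong i j k l {F} {G} {H} a b rec = begin
    timesXY (suc i) j F a b
      ≈⟨ timesXY-cong< i j a b rec ⟩
    timesXY (suc i) j (λ a b → G a b ⊕ φ (timesXY k l H a b)) a b
      ≈⟨ timesXY-⊕ (suc i) j G (λ a b → φ (timesXY k l H a b)) a b ⟩
    timesXY (suc i) j G a b ⊕ timesXY (suc i) j (λ a b → φ (timesXY k l H a b)) a b
      ≈⟨ ⊕-congʳ (timesXY (suc i) j G a b) (timesXY-map φ φ0 (suc i) j (timesXY k l H) a b) ⟩
    timesXY (suc i) j G a b ⊕ φ (timesXY (suc i) j (timesXY k l H) a b)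
      ≈⟨ ⊕-congʳ (timesXY (suc i) j G a b) (φ-cong (timesXY-timesXY (suc i) j k l H a b)) ⟩
    timesXY (suc i) j G a b ⊕ φ (timesXY (suc i + k) (j + l) H a b) ∎
    where open ≗-Reasoning

  timesXY-y≤ : ∀ j F a {b} → j ≤ b → timesXY 0 j F a b ≡ F a (b ∸ j)
  timesXY-y≤ zero    F a _         = refl
  timesXY-y≤ (suc j) F a (s≤s j≤b) = timesXY-y≤ j F a j≤b

  timesXY-y> : ∀ j F a {b} → b < j → timesXY 0 j F a b ≡ zeroS
  timesXY-y> (suc j) F a {zero}  _         = refl
  timesXY-y> (suc j) F a {suc b} (s≤s b<j) = timesXY-y> j F a b<j

module Summands where

  open import Defs
  open PowerSeries
  open import Data.Nat as ℕ using (ℕ; suc; s≤s; z≤n; _*_; _+_)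
  open import Data.Nat.Properties as ℕP using ()
  open import Data.Nat.Combinatorics using (_C_; nC1≡n; nCk+nC[k+1]≡[n+1]C[k+1])
  open import Data.Nat.Solver using (module +-*-Solver)
  open import Data.Integer using (-_)
  open import Data.Integer.Properties using (neg-distribˡ-*)
  open import Relation.Binary.PropositionalEquality
  open +-*-Solver using (solve; _:+_; _:*_; _:=_; con; Polynomial)

  sucC2 : ∀ n → suc n C 2 ≡ n + n C 2
  sucC2 n = trans (sym (nCk+nC[k+1]≡[n+1]C[k+1] n 1)) (cong (_+ n C 2) (nC1≡n n))

  private
    -- qExp with the binomials n C 2 abstracted to variables x
    Q : ∀ {m} → (c₁ c₂ c₃ n₁ n₂ n₃ x₁ x₂ x₃ : Polynomial m) → Polynomial m
    Q c₁ c₂ c₃ n₁ n₂ n₃ x₁ x₂ x₃ =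
      con 4 :* x₁ :+ con 4 :* x₂ :+ con 18 :* x₃
      :+ con 2 :* n₁ :* n₂ :+ con 6 :* n₂ :* n₃ :+ con 6 :* n₃ :* n₁
      :+ c₁ :* n₁ :+ c₂ :* n₂ :+ c₃ :* n₃

  qExp-linear : ∀ c₁ c₂ c₃ n₁ n₂ n₃ →
    qExp c₁ c₂ c₃ n₁ n₂ n₃ ≡ qExp 0 0 0 n₁ n₂ n₃ + (c₁ * n₁ + c₂ * n₂ + c₃ * n₃)
  qExp-linear c₁ c₂ c₃ n₁ n₂ n₃ =
    solve 9 (λ c₁ c₂ c₃ n₁ n₂ n₃ x₁ x₂ x₃ →
      Q c₁ c₂ c₃ n₁ n₂ n₃ x₁ x₂ x₃ := Q (con 0) (con 0) (con 0) n₁ n₂ n₃ x₁ x₂ x₃ :+ (c₁ :* n₁ :+ c₂ :* n₂ :+ c₃ :* n₃))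
      refl c₁ c₂ c₃ n₁ n₂ n₃ (n₁ C 2) (n₂ C 2) (n₃ C 2)

  qExp-bump : ∀ c₁ c₂ c₃ d₁ d₂ d₃ n₁ n₂ n₃ →
    d₁ * n₁ + (d₂ * n₂ + (d₃ * n₃ + qExp c₁ c₂ c₃ n₁ n₂ n₃))
      ≡ qExp (d₁ + c₁) (d₂ + c₂) (d₃ + c₃) n₁ n₂ n₃
  qExp-bump c₁ c₂ c₃ d₁ d₂ d₃ n₁ n₂ n₃ =
    solve 12 (λ c₁ c₂ c₃ d₁ d₂ d₃ n₁ n₂ n₃ x₁ x₂ x₃ →
      d₁ :* n₁ :+ (d₂ :* n₂ :+ (d₃ :* n₃ :+ Q c₁ c₂ c₃ n₁ n₂ n₃ x₁ x₂ x₃))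
        := Q (d₁ :+ c₁) (d₂ :+ c₂) (d₃ :+ c₃) n₁ n₂ n₃ x₁ x₂ x₃)
      refl c₁ c₂ c₃ d₁ d₂ d₃ n₁ n₂ n₃ (n₁ C 2) (n₂ C 2) (n₃ C 2)

  qExp-suc₁ : ∀ c₁ c₂ c₃ n₁ n₂ n₃ →
    qExp c₁ c₂ c₃ (suc n₁) n₂ n₃ ≡ c₁ + qExp (4 + c₁) (2 + c₂) (6 + c₃) n₁ n₂ n₃
  qExp-suc₁ c₁ c₂ c₃ n₁ n₂ n₃ rewrite sucC2 n₁ =
    solve 9 (λ c₁ c₂ c₃ n₁ n₂ n₃ x₁ x₂ x₃ →
      Q c₁ c₂ c₃ (con 1 :+ n₁) n₂ n₃ (n₁ :+ x₁) x₂ x₃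
        := c₁ :+ Q (con 4 :+ c₁) (con 2 :+ c₂) (con 6 :+ c₃) n₁ n₂ n₃ x₁ x₂ x₃)
      refl c₁ c₂ c₃ n₁ n₂ n₃ (n₁ C 2) (n₂ C 2) (n₃ C 2)

  qExp-suc₂ : ∀ c₁ c₂ c₃ n₁ n₂ n₃ →
    qExp c₁ c₂ c₃ n₁ (suc n₂) n₃ ≡ c₂ + qExp (2 + c₁) (4 + c₂) (6 + c₃) n₁ n₂ n₃
  qExp-suc₂ c₁ c₂ c₃ n₁ n₂ n₃ rewrite sucC2 n₂ =
    solve 9 (λ c₁ c₂ c₃ n₁ n₂ n₃ x₁ x₂ x₃ →
      Q c₁ c₂ c₃ n₁ (con 1 :+ n₂) n₃ x₁ (n₂ :+ x₂) x₃
        := c₂ :+ Q (con 2 :+ c₁) (con 4 :+ c₂) (con 6 :+ c₃) n₁ n₂ n₃ x₁ x₂ x₃)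
      refl c₁ c₂ c₃ n₁ n₂ n₃ (n₁ C 2) (n₂ C 2) (n₃ C 2)

  qExp-suc₃ : ∀ c₁ c₂ c₃ n₁ n₂ n₃ →
    qExp c₁ c₂ c₃ n₁ n₂ (suc n₃) ≡ c₃ + qExp (6 + c₁) (6 + c₂) (18 + c₃) n₁ n₂ n₃
  qExp-suc₃ c₁ c₂ c₃ n₁ n₂ n₃ rewrite sucC2 n₃ =
    solve 9 (λ c₁ c₂ c₃ n₁ n₂ n₃ x₁ x₂ x₃ →
      Q c₁ c₂ c₃ n₁ n₂ (con 1 :+ n₃) x₁ x₂ (n₃ :+ x₃)
        := c₃ :+ Q (con 6 :+ c₁) (con 6 :+ c₂) (con 18 :+ c₃) n₁ n₂ n₃ x₁ x₂ x₃)
      refl c₁ c₂ c₃ n₁ n₂ n₃ (n₁ C 2) (n₂ C 2) (n₃ C 2)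

  recipDenom : ℕ → ℕ → ℕ → FPS
  recipDenom n₁ n₂ n₃ = (invPoch 2 n₁ ⊛ invPoch 2 n₂) ⊛ invPoch 6 n₃

  term : ℕ → ℕ → ℕ → ℕ → ℕ → ℕ → FPS
  term c₁ c₂ c₃ n₁ n₂ n₃ = shift (qExp c₁ c₂ c₃ n₁ n₂ n₃) (scale (negOnePow n₃) (recipDenom n₁ n₂ n₃))

  shift-scale-⊛ : ∀ e s f g → (shift e (scale s f) ⊛ g) ≗ shift e (scale s (f ⊛ g))
  shift-scale-⊛ e s f g = begin
    shift e (scale s f) ⊛ g  ≈⟨ shift-⊛ˡ e (scale s f) g ⟩
    shift e (scale s f ⊛ g)  ≈⟨ shift-cong e (scale-⊛ s f g) ⟩
    shift e (scale s (f ⊛ g)) ∎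
    where open ≗-Reasoning

  summand≗term : ∀ c₁ c₂ c₃ n₁ n₂ n₃ → summand c₁ c₂ c₃ n₁ n₂ n₃ ≗ term c₁ c₂ c₃ n₁ n₂ n₃
  summand≗term c₁ c₂ c₃ n₁ n₂ n₃ = begin
    ((mono s E ⊛ I₁) ⊛ I₂) ⊛ I₃            ≈⟨ ⊛-congˡ I₃ (⊛-congˡ I₂ (⊛-congˡ I₁ (mono≗shift s E))) ⟩
    ((shift E (mono s 0) ⊛ I₁) ⊛ I₂) ⊛ I₃  ≈⟨ ⊛-congˡ I₃ (⊛-congˡ I₂ (shift-⊛ˡ E (mono s 0) I₁)) ⟩
    (shift E (mono s 0 ⊛ I₁) ⊛ I₂) ⊛ I₃    ≈⟨ ⊛-congˡ I₃ (⊛-congˡ I₂ (shift-cong E (mono0-⊛ s I₁))) ⟩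
    (shift E (scale s I₁) ⊛ I₂) ⊛ I₃       ≈⟨ ⊛-congˡ I₃ (shift-scale-⊛ E s I₁ I₂) ⟩
    shift E (scale s (I₁ ⊛ I₂)) ⊛ I₃       ≈⟨ shift-scale-⊛ E s (I₁ ⊛ I₂) I₃ ⟩
    term c₁ c₂ c₃ n₁ n₂ n₃ ∎
    where
    open ≗-Reasoning
    E  = qExp c₁ c₂ c₃ n₁ n₂ n₃
    s  = negOnePow n₃
    I₁ = invPoch 2 n₁
    I₂ = invPoch 2 n₂
    I₃ = invPoch 6 n₃

  recipDenom-unfold₁ : ∀ n₁ n₂ n₃ →
    recipDenom (suc n₁) n₂ n₃ ≗ (recipDenom n₁ n₂ n₃ ⊕ shift (2 * suc n₁) (recipDenom (suc n₁) n₂ n₃))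
  recipDenom-unfold₁ n₁ n₂ n₃ =
    unfold-⊛ˡ k (I₁ ⊛ I₂) (I₁′ ⊛ I₂) (invPoch 6 n₃) (unfold-⊛ˡ k I₁ I₁′ I₂ (invPoch-unfold 2 n₁ (s≤s z≤n)))
    where
    k = 2 * suc n₁
    I₁ = invPoch 2 n₁
    I₁′ = invPoch 2 (suc n₁)
    I₂ = invPoch 2 n₂

  recipDenom-unfold₂ : ∀ n₁ n₂ n₃ →
    recipDenom n₁ (suc n₂) n₃ ≗ (recipDenom n₁ n₂ n₃ ⊕ shift (2 * suc n₂) (recipDenom n₁ (suc n₂) n₃))
  recipDenom-unfold₂ n₁ n₂ n₃ =
    unfold-⊛ˡ k (I₁ ⊛ I₂) (I₁ ⊛ I₂′) (invPoch 6 n₃) (unfold-⊛ʳ k I₂ I₂′ I₁ (invPoch-unfold 2 n₂ (s≤s z≤n)))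
    where
    k = 2 * suc n₂
    I₁ = invPoch 2 n₁
    I₂ = invPoch 2 n₂
    I₂′ = invPoch 2 (suc n₂)

  recipDenom-unfold₃ : ∀ n₁ n₂ n₃ →
    recipDenom n₁ n₂ (suc n₃) ≗ (recipDenom n₁ n₂ n₃ ⊕ shift (6 * suc n₃) (recipDenom n₁ n₂ (suc n₃)))
  recipDenom-unfold₃ n₁ n₂ n₃ =
    unfold-⊛ʳ (6 * suc n₃) (invPoch 6 n₃) (invPoch 6 (suc n₃)) (invPoch 2 n₁ ⊛ invPoch 2 n₂)
      (invPoch-unfold 6 n₃ (s≤s z≤n))

  -- The exponents are taken in the shape in which they occur in the summands.
  signed-unfold : ∀ s k c e′ D₀ D₁ {e e₁ D} → D ≗ (D₀ ⊕ shift k D₁) → k + e ≡ e₁ → e ≡ c + e′ →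
    shift e (scale s D) ≗ (shift e₁ (scale s D₁) ⊕ shift c (shift e′ (scale s D₀)))
  signed-unfold s k c e′ D₀ D₁ {e} {e₁} {D} D≗ k+e≡e₁ e≡c+e′ = begin
    shift e (scale s D)                                       ≈⟨ shift-cong e (scale-cong s D≗) ⟩
    shift e (scale s (D₀ ⊕ shift k D₁))                       ≈⟨ shift-cong e (scale-distrib-⊕ s D₀ (shift k D₁)) ⟩
    shift e (scale s D₀ ⊕ scale s (shift k D₁))               ≈⟨ shift-distrib-⊕ e (scale s D₀) (scale s (shift k D₁)) ⟩
    shift e (scale s D₀) ⊕ shift e (scale s (shift k D₁))     ≈⟨ ⊕-comm (shift e (scale s D₀)) _ ⟩
    shift e (scale s (shift k D₁)) ⊕ shift e (scale s D₀)     ≈⟨ ⊕-cong (shift-cong e (shift-scale k s D₁)) ≗-refl ⟨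
    shift e (shift k (scale s D₁)) ⊕ shift e (scale s D₀)     ≈⟨ ⊕-cong (shift-shift e k (scale s D₁)) (shift-≡ _ e≡c+e′) ⟩
    shift (e + k) (scale s D₁) ⊕ shift (c + e′) (scale s D₀)  ≈⟨ ⊕-cong (shift-≡ _ (trans (ℕP.+-comm e k) k+e≡e₁))
                                                                         (≗-sym (shift-shift c e′ (scale s D₀))) ⟩
    shift e₁ (scale s D₁) ⊕ shift c (shift e′ (scale s D₀)) ∎
    where open ≗-Reasoning

  term-unfold₁ : ∀ c₁ c₂ c₃ n₁ n₂ n₃ →
    term c₁ c₂ c₃ (suc n₁) n₂ n₃
      ≗ (term (2 + c₁) c₂ c₃ (suc n₁) n₂ n₃ ⊕ shift c₁ (term (4 + c₁) (2 + c₂) (6 + c₃) n₁ n₂ n₃))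
  term-unfold₁ c₁ c₂ c₃ n₁ n₂ n₃ =
    signed-unfold (negOnePow n₃) (2 * suc n₁) c₁ (qExp (4 + c₁) (2 + c₂) (6 + c₃) n₁ n₂ n₃)
                  (recipDenom n₁ n₂ n₃) (recipDenom (suc n₁) n₂ n₃) (recipDenom-unfold₁ n₁ n₂ n₃)
                  (qExp-bump c₁ c₂ c₃ 2 0 0 (suc n₁) n₂ n₃) (qExp-suc₁ c₁ c₂ c₃ n₁ n₂ n₃)

  term-unfold₂ : ∀ c₁ c₂ c₃ n₁ n₂ n₃ →
    term c₁ c₂ c₃ n₁ (suc n₂) n₃
      ≗ (term c₁ (2 + c₂) c₃ n₁ (suc n₂) n₃ ⊕ shift c₂ (term (2 + c₁) (4 + c₂) (6 + c₃) n₁ n₂ n₃))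
  term-unfold₂ c₁ c₂ c₃ n₁ n₂ n₃ =
    signed-unfold (negOnePow n₃) (2 * suc n₂) c₂ (qExp (2 + c₁) (4 + c₂) (6 + c₃) n₁ n₂ n₃)
                  (recipDenom n₁ n₂ n₃) (recipDenom n₁ (suc n₂) n₃) (recipDenom-unfold₂ n₁ n₂ n₃)
                  (qExp-bump c₁ c₂ c₃ 0 2 0 n₁ (suc n₂) n₃) (qExp-suc₂ c₁ c₂ c₃ n₁ n₂ n₃)

  term-unfold₃ : ∀ c₁ c₂ c₃ n₁ n₂ n₃ →
    term c₁ c₂ c₃ n₁ n₂ (suc n₃)
      ≗ (term c₁ c₂ (6 + c₃) n₁ n₂ (suc n₃) ⊕ negate (shift c₃ (term (6 + c₁) (6 + c₂) (18 + c₃) n₁ n₂ n₃)))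
  term-unfold₃ c₁ c₂ c₃ n₁ n₂ n₃ =
    ≗-trans (signed-unfold (- s) (6 * suc n₃) c₃ E′ D₀ (recipDenom n₁ n₂ (suc n₃)) (recipDenom-unfold₃ n₁ n₂ n₃)
                           (qExp-bump c₁ c₂ c₃ 0 0 6 n₁ n₂ (suc n₃)) (qExp-suc₃ c₁ c₂ c₃ n₁ n₂ n₃))
            (⊕-congʳ (term c₁ c₂ (6 + c₃) n₁ n₂ (suc n₃)) sign)
    where
    s = negOnePow n₃
    E′ = qExp (6 + c₁) (6 + c₂) (18 + c₃) n₁ n₂ n₃
    D₀ = recipDenom n₁ n₂ n₃
    sign : shift c₃ (shift E′ (scale (- s) D₀)) ≗ negate (shift c₃ (shift E′ (scale s D₀)))
    sign = ≗-trans (shift-cong c₃ (≗-trans (shift-cong E′ (λ n → sym (neg-distribˡ-* s (D₀ n))))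
                                           (shift-negate E′ (scale s D₀))))
                   (shift-negate c₃ (shift E′ (scale s D₀)))

  term-linearPart : ∀ c₁ c₂ c₃ d₁ d₂ d₃ n₁ n₂ n₃ →
    c₁ * n₁ + c₂ * n₂ + c₃ * n₃ ≡ d₁ * n₁ + d₂ * n₂ + d₃ * n₃ →
    term c₁ c₂ c₃ n₁ n₂ n₃ ≗ term d₁ d₂ d₃ n₁ n₂ n₃
  term-linearPart c₁ c₂ c₃ d₁ d₂ d₃ n₁ n₂ n₃ eq =
    shift-≡ (scale (negOnePow n₃) (recipDenom n₁ n₂ n₃))
      (trans (qExp-linear c₁ c₂ c₃ n₁ n₂ n₃)
        (trans (cong (qExp 0 0 0 n₁ n₂ n₃ +_) eq) (sym (qExp-linear d₁ d₂ d₃ n₁ n₂ n₃))))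

  private
    *0≡*0 : ∀ c d → c * 0 ≡ d * 0
    *0≡*0 c d = trans (ℕP.*-zeroʳ c) (sym (ℕP.*-zeroʳ d))

  term-indep₁ : ∀ c₁ d₁ c₂ c₃ n₁ n₂ n₃ → n₁ ≡ 0 → term c₁ c₂ c₃ n₁ n₂ n₃ ≗ term d₁ c₂ c₃ n₁ n₂ n₃
  term-indep₁ c₁ d₁ c₂ c₃ _ n₂ n₃ refl =
    term-linearPart c₁ c₂ c₃ d₁ c₂ c₃ 0 n₂ n₃ (cong (λ m → m + c₂ * n₂ + c₃ * n₃) (*0≡*0 c₁ d₁))

  term-indep₂ : ∀ c₁ c₂ d₂ c₃ n₁ n₂ n₃ → n₂ ≡ 0 → term c₁ c₂ c₃ n₁ n₂ n₃ ≗ term c₁ d₂ c₃ n₁ n₂ n₃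
  term-indep₂ c₁ c₂ d₂ c₃ n₁ _ n₃ refl =
    term-linearPart c₁ c₂ c₃ c₁ d₂ c₃ n₁ 0 n₃ (cong (λ m → c₁ * n₁ + m + c₃ * n₃) (*0≡*0 c₂ d₂))

  term-indep₃ : ∀ c₁ c₂ c₃ d₃ n₁ n₂ n₃ → n₃ ≡ 0 → term c₁ c₂ c₃ n₁ n₂ n₃ ≗ term c₁ c₂ d₃ n₁ n₂ n₃
  term-indep₃ c₁ c₂ c₃ d₃ n₁ n₂ _ refl =
    term-linearPart c₁ c₂ c₃ c₁ c₂ d₃ n₁ n₂ 0 (cong (c₁ * n₁ + c₂ * n₂ +_) (*0≡*0 c₃ d₃))

  term-shift6 : ∀ c₁ c₂ c₃ n₁ n₂ n₃ →
    term (6 + c₁) (6 + c₂) (12 + c₃) n₁ n₂ n₃ ≗ shift (6 * (n₁ + n₂ + 2 * n₃)) (term c₁ c₂ c₃ n₁ n₂ n₃)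
  term-shift6 c₁ c₂ c₃ n₁ n₂ n₃ =
    ≗-trans (shift-≡ X (trans (sym (qExp-bump c₁ c₂ c₃ 6 6 12 n₁ n₂ n₃)) regroup))
            (≗-sym (shift-shift (6 * (n₁ + n₂ + 2 * n₃)) (qExp c₁ c₂ c₃ n₁ n₂ n₃) X))
    where
    X = scale (negOnePow n₃) (recipDenom n₁ n₂ n₃)
    regroup : 6 * n₁ + (6 * n₂ + (12 * n₃ + qExp c₁ c₂ c₃ n₁ n₂ n₃))
              ≡ 6 * (n₁ + n₂ + 2 * n₃) + qExp c₁ c₂ c₃ n₁ n₂ n₃
    regroup = solve 4 (λ n₁ n₂ n₃ E → con 6 :* n₁ :+ (con 6 :* n₂ :+ (con 12 :* n₃ :+ E))
                                       := con 6 :* (n₁ :+ n₂ :+ con 2 :* n₃) :+ E)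
                      refl n₁ n₂ n₃ (qExp c₁ c₂ c₃ n₁ n₂ n₃)

module Coefficients where

  open import Defs
  open PowerSeries
  open Summands
  open BivariateSeries
  open import Data.Nat as ℕ using (ℕ; zero; suc; _∸_; _≤_; z≤n; s≤s; _≤?_; _*_; _+_)
  open import Data.Nat.Properties as ℕP using ()
  open import Data.Empty using (⊥-elim)
  open import Data.Integer using (-_; 1ℤ)
  open import Data.Integer.Properties using (*-identityˡ)
  open FiniteSums using (Σ<-zero)
  open import Data.Nat.Solver using (module +-*-Solver)
  open +-*-Solver using (solve; _:+_; _:*_; _:=_; con)
  open import Relation.Binary.PropositionalEquality
  open import Relation.Nullary using (yes; no; ¬_)

  -- The summand with n₃ = k, n₂ = b - k, n₁ = a - b - k of the coefficient of x^a y^b;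
  -- it is zero when this triple is not in ℕ³ (k ≤ b is guaranteed by the range of k).
  cell : ℕ → ℕ → ℕ → ℕ → ℕ → ℕ → FPS
  cell c₁ c₂ c₃ a b k = select (b + k ≤? a) (term c₁ c₂ c₃ (a ∸ b ∸ k) (b ∸ k) k)

  coeffXY : ℕ → ℕ → ℕ → ℕ → ℕ → FPS
  coeffXY c₁ c₂ c₃ a b = ΣS (suc b) (cell c₁ c₂ c₃ a b)

  cell-valid : ∀ c₁ c₂ c₃ {a b k} n₁ n₂ → n₂ + k ≡ b → b + k + n₁ ≡ a →
               cell c₁ c₂ c₃ a b k ≗ term c₁ c₂ c₃ n₁ n₂ k
  cell-valid c₁ c₂ c₃ {k = k} n₁ n₂ refl refl =
    ≗-trans (select-yes (b + k ≤? b + k + n₁) (ℕP.m≤m+n (b + k) n₁))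
            (λ N → cong₂ (λ m₁ m₂ → term c₁ c₂ c₃ m₁ m₂ k N)
                         (trans (ℕP.∸-+-assoc (b + k + n₁) b k) (ℕP.m+n∸m≡n (b + k) n₁))
                         (ℕP.m+n∸n≡m n₂ k))
    where b = n₂ + k

  cell-invalid : ∀ c₁ c₂ c₃ a b k → ¬ (b + k ≤ a) → cell c₁ c₂ c₃ a b k ≗ zeroS
  cell-invalid c₁ c₂ c₃ a b k = select-no (b + k ≤? a)

  cell-indep₁ : ∀ c₁ d₁ c₂ c₃ a b k → (b + k ≤ a → a ∸ b ∸ k ≡ 0) → cell c₁ c₂ c₃ a b k ≗ cell d₁ c₂ c₃ a b k
  cell-indep₁ c₁ d₁ c₂ c₃ a b k n₁≡0 =
    select-cong (b + k ≤? a) (λ valid → term-indep₁ c₁ d₁ c₂ c₃ (a ∸ b ∸ k) (b ∸ k) k (n₁≡0 valid))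

  cell-indep₂ : ∀ c₁ c₂ d₂ c₃ a b k → (b + k ≤ a → b ∸ k ≡ 0) → cell c₁ c₂ c₃ a b k ≗ cell c₁ d₂ c₃ a b k
  cell-indep₂ c₁ c₂ d₂ c₃ a b k n₂≡0 =
    select-cong (b + k ≤? a) (λ valid → term-indep₂ c₁ c₂ d₂ c₃ (a ∸ b ∸ k) (b ∸ k) k (n₂≡0 valid))

  cell-indep₃ : ∀ c₁ c₂ c₃ d₃ a b k → (b + k ≤ a → k ≡ 0) → cell c₁ c₂ c₃ a b k ≗ cell c₁ c₂ d₃ a b k
  cell-indep₃ c₁ c₂ c₃ d₃ a b k n₃≡0 =
    select-cong (b + k ≤? a) (λ valid → term-indep₃ c₁ c₂ c₃ d₃ (a ∸ b ∸ k) (b ∸ k) k (n₃≡0 valid))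

  cell-unfold₁ : ∀ c₁ c₂ c₃ a b k → k ≤ b →
    cell c₁ c₂ c₃ (suc a) b k
      ≗ (cell (2 + c₁) c₂ c₃ (suc a) b k ⊕ shift c₁ (cell (4 + c₁) (2 + c₂) (6 + c₃) a b k))
  cell-unfold₁ c₁ c₂ c₃ a b k k≤b with b + k ≤? a
  ... | yes b+k≤a = begin
    cell c₁ c₂ c₃ (suc a) b k
      ≈⟨ cell-valid c₁ c₂ c₃ (suc n₁) n₂ eq₂ eq₁′ ⟩
    term c₁ c₂ c₃ (suc n₁) n₂ k
      ≈⟨ term-unfold₁ c₁ c₂ c₃ n₁ n₂ k ⟩
    term (2 + c₁) c₂ c₃ (suc n₁) n₂ k ⊕ shift c₁ (term (4 + c₁) (2 + c₂) (6 + c₃) n₁ n₂ k)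
      ≈⟨ ⊕-cong (cell-valid (2 + c₁) c₂ c₃ (suc n₁) n₂ eq₂ eq₁′)
                (shift-cong c₁ (cell-valid (4 + c₁) (2 + c₂) (6 + c₃) n₁ n₂ eq₂ eq₁)) ⟨
    cell (2 + c₁) c₂ c₃ (suc a) b k ⊕ shift c₁ (cell (4 + c₁) (2 + c₂) (6 + c₃) a b k) ∎
    where
    open ≗-Reasoning
    n₁ = a ∸ (b + k)
    n₂ = b ∸ k
    eq₂ : n₂ + k ≡ b
    eq₂ = ℕP.m∸n+n≡m k≤b
    eq₁ : b + k + n₁ ≡ a
    eq₁ = ℕP.m+[n∸m]≡n b+k≤a
    eq₁′ : b + k + suc n₁ ≡ suc a
    eq₁′ = trans (ℕP.+-suc (b + k) n₁) (cong suc eq₁)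
  ... | no b+k≰a =
    ≗-trans (cell-indep₁ c₁ (2 + c₁) c₂ c₃ (suc a) b k (λ _ → n₁≡0))
            (≗-sym (⊕-shift-vanish _ c₁ (cell-invalid (4 + c₁) (2 + c₂) (6 + c₃) a b k b+k≰a)))
    where
    n₁≡0 : suc a ∸ b ∸ k ≡ 0
    n₁≡0 = trans (ℕP.∸-+-assoc (suc a) b k) (ℕP.m≤n⇒m∸n≡0 (ℕP.≰⇒> b+k≰a))

  cell-unfold₂ : ∀ c₁ c₂ c₃ a b k → k ≤ b →
    cell c₁ c₂ c₃ (suc a) (suc b) k
      ≗ (cell c₁ (2 + c₂) c₃ (suc a) (suc b) k ⊕ shift c₂ (cell (2 + c₁) (4 + c₂) (6 + c₃) a b k))
  cell-unfold₂ c₁ c₂ c₃ a b k k≤b with b + k ≤? a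
  ... | yes b+k≤a = begin
    cell c₁ c₂ c₃ (suc a) (suc b) k
      ≈⟨ cell-valid c₁ c₂ c₃ n₁ (suc n₂) (cong suc eq₂) (cong suc eq₁) ⟩
    term c₁ c₂ c₃ n₁ (suc n₂) k
      ≈⟨ term-unfold₂ c₁ c₂ c₃ n₁ n₂ k ⟩
    term c₁ (2 + c₂) c₃ n₁ (suc n₂) k ⊕ shift c₂ (term (2 + c₁) (4 + c₂) (6 + c₃) n₁ n₂ k)
      ≈⟨ ⊕-cong (cell-valid c₁ (2 + c₂) c₃ n₁ (suc n₂) (cong suc eq₂) (cong suc eq₁))
                (shift-cong c₂ (cell-valid (2 + c₁) (4 + c₂) (6 + c₃) n₁ n₂ eq₂ eq₁)) ⟨
    cell c₁ (2 + c₂) c₃ (suc a) (suc b) k ⊕ shift c₂ (cell (2 + c₁) (4 + c₂) (6 + c₃) a b k) ∎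
    where
    open ≗-Reasoning
    n₁ = a ∸ (b + k)
    n₂ = b ∸ k
    eq₂ : n₂ + k ≡ b
    eq₂ = ℕP.m∸n+n≡m k≤b
    eq₁ : b + k + n₁ ≡ a
    eq₁ = ℕP.m+[n∸m]≡n b+k≤a
  ... | no b+k≰a =
    ≗-trans (cell-indep₂ c₁ c₂ (2 + c₂) c₃ (suc a) (suc b) k (λ valid → ⊥-elim (b+k≰a (ℕP.≤-pred valid))))
            (≗-sym (⊕-shift-vanish _ c₂ (cell-invalid (2 + c₁) (4 + c₂) (6 + c₃) a b k b+k≰a)))

  cell-unfold₃ : ∀ c₁ c₂ c₃ a b j → j ≤ b →
    cell c₁ c₂ c₃ (suc (suc a)) (suc b) (suc j)
      ≗ (cell c₁ c₂ (6 + c₃) (suc (suc a)) (suc b) (suc j)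
          ⊕ negate (shift c₃ (cell (6 + c₁) (6 + c₂) (18 + c₃) a b j)))
  cell-unfold₃ c₁ c₂ c₃ a b j j≤b with b + j ≤? a
  ... | yes b+j≤a = begin
    cell c₁ c₂ c₃ (suc (suc a)) (suc b) (suc j)
      ≈⟨ cell-valid c₁ c₂ c₃ n₁ n₂ eq₂′ eq₁′ ⟩
    term c₁ c₂ c₃ n₁ n₂ (suc j)
      ≈⟨ term-unfold₃ c₁ c₂ c₃ n₁ n₂ j ⟩
    term c₁ c₂ (6 + c₃) n₁ n₂ (suc j) ⊕ negate (shift c₃ (term (6 + c₁) (6 + c₂) (18 + c₃) n₁ n₂ j))
      ≈⟨ ⊕-cong (cell-valid c₁ c₂ (6 + c₃) n₁ n₂ eq₂′ eq₁′)
                (negate-cong (shift-cong c₃ (cell-valid (6 + c₁) (6 + c₂) (18 + c₃) n₁ n₂ eq₂ eq₁))) ⟨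
    cell c₁ c₂ (6 + c₃) (suc (suc a)) (suc b) (suc j)
      ⊕ negate (shift c₃ (cell (6 + c₁) (6 + c₂) (18 + c₃) a b j)) ∎
    where
    open ≗-Reasoning
    n₁ = a ∸ (b + j)
    n₂ = b ∸ j
    eq₂ : n₂ + j ≡ b
    eq₂ = ℕP.m∸n+n≡m j≤b
    eq₁ : b + j + n₁ ≡ a
    eq₁ = ℕP.m+[n∸m]≡n b+j≤a
    eq₂′ : n₂ + suc j ≡ suc b
    eq₂′ = trans (ℕP.+-suc n₂ j) (cong suc eq₂)
    eq₁′ : suc b + suc j + n₁ ≡ suc (suc a)
    eq₁′ = cong suc (trans (cong (_+ n₁) (ℕP.+-suc b j)) (cong suc eq₁))
  ... | no b+j≰a =
    ≗-trans (cell-indep₃ c₁ c₂ c₃ (6 + c₃) (suc (suc a)) (suc b) (suc j) (λ valid → ⊥-elim (b+j≰a (shrink valid))))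
            (≗-sym (negate-shift-vanish _ c₃ (cell-invalid (6 + c₁) (6 + c₂) (18 + c₃) a b j b+j≰a)))
    where
    shrink : suc b + suc j ≤ suc (suc a) → b + j ≤ a
    shrink b+j+2≤a+2 = ℕP.≤-pred (subst (_≤ suc a) (ℕP.+-suc b j) (ℕP.≤-pred b+j+2≤a+2))

  coeffXY-indep₁ : ∀ c₁ d₁ c₂ c₃ a b → (∀ k → b + k ≤ a → a ∸ b ∸ k ≡ 0) →
    coeffXY c₁ c₂ c₃ a b ≗ coeffXY d₁ c₂ c₃ a b
  coeffXY-indep₁ c₁ d₁ c₂ c₃ a b n₁≡0 = ΣS-cong (suc b) (λ k _ → cell-indep₁ c₁ d₁ c₂ c₃ a b k (n₁≡0 k))

  coeffXY-indep₂ : ∀ c₁ c₂ d₂ c₃ a b → (∀ k → b + k ≤ a → b ∸ k ≡ 0) →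
    coeffXY c₁ c₂ c₃ a b ≗ coeffXY c₁ d₂ c₃ a b
  coeffXY-indep₂ c₁ c₂ d₂ c₃ a b n₂≡0 = ΣS-cong (suc b) (λ k _ → cell-indep₂ c₁ c₂ d₂ c₃ a b k (n₂≡0 k))

  coeffXY-indep₃ : ∀ c₁ c₂ c₃ d₃ a b → (∀ k → k ≤ b → b + k ≤ a → k ≡ 0) →
    coeffXY c₁ c₂ c₃ a b ≗ coeffXY c₁ c₂ d₃ a b
  coeffXY-indep₃ c₁ c₂ c₃ d₃ a b n₃≡0 =
    ΣS-cong (suc b) (λ k k<1+b → cell-indep₃ c₁ c₂ c₃ d₃ a b k (n₃≡0 k (ℕP.≤-pred k<1+b)))

  coeffXY-unfold₁ : ∀ c₁ c₂ c₃ a b →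
    coeffXY c₁ c₂ c₃ a b
      ≗ (coeffXY (2 + c₁) c₂ c₃ a b ⊕ shift c₁ (timesXY 1 0 (coeffXY (4 + c₁) (2 + c₂) (6 + c₃)) a b))
  coeffXY-unfold₁ c₁ c₂ c₃ zero b =
    ≗-trans (coeffXY-indep₁ c₁ (2 + c₁) c₂ c₃ 0 b λ k _ → trans (cong (_∸ k) (ℕP.0∸n≡0 b)) (ℕP.0∸n≡0 k))
            (≗-sym (⊕-shift-vanish _ c₁ ≗-refl))
  coeffXY-unfold₁ c₁ c₂ c₃ (suc a) b = begin
    ΣS (suc b) (cell c₁ c₂ c₃ (suc a) b)
      ≈⟨ ΣS-cong (suc b) (λ k k<1+b → cell-unfold₁ c₁ c₂ c₃ a b k (ℕP.≤-pred k<1+b)) ⟩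
    ΣS (suc b) (λ k → cell (2 + c₁) c₂ c₃ (suc a) b k ⊕ shift c₁ (cell c′ c″ c‴ a b k))
      ≈⟨ ΣS-distrib-⊕ (suc b) (cell (2 + c₁) c₂ c₃ (suc a) b) (λ k → shift c₁ (cell c′ c″ c‴ a b k)) ⟩
    coeffXY (2 + c₁) c₂ c₃ (suc a) b ⊕ ΣS (suc b) (λ k → shift c₁ (cell c′ c″ c‴ a b k))
      ≈⟨ ⊕-congʳ (coeffXY (2 + c₁) c₂ c₃ (suc a) b) (shift-ΣS c₁ (suc b) (cell c′ c″ c‴ a b)) ⟨
    coeffXY (2 + c₁) c₂ c₃ (suc a) b ⊕ shift c₁ (coeffXY c′ c″ c‴ a b) ∎
    where
    open ≗-Reasoning
    c′ = 4 + c₁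
    c″ = 2 + c₂
    c‴ = 6 + c₃

  coeffXY-unfold₂ : ∀ c₁ c₂ c₃ a b →
    coeffXY c₁ c₂ c₃ a b
      ≗ (coeffXY c₁ (2 + c₂) c₃ a b ⊕ shift c₂ (timesXY 1 1 (coeffXY (2 + c₁) (4 + c₂) (6 + c₃)) a b))
  coeffXY-unfold₂ c₁ c₂ c₃ zero b =
    ≗-trans (coeffXY-indep₂ c₁ c₂ (2 + c₂) c₃ 0 b n₂≡0) (≗-sym (⊕-shift-vanish _ c₂ ≗-refl))
    where
    n₂≡0 : ∀ k → b + k ≤ 0 → b ∸ k ≡ 0
    n₂≡0 k b+k≤0 = trans (cong (_∸ k) (ℕP.m+n≡0⇒m≡0 b (ℕP.n≤0⇒n≡0 b+k≤0))) (ℕP.0∸n≡0 k)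
  coeffXY-unfold₂ c₁ c₂ c₃ (suc a) zero =
    ≗-trans (coeffXY-indep₂ c₁ c₂ (2 + c₂) c₃ (suc a) 0 (λ k _ → ℕP.0∸n≡0 k)) (≗-sym (⊕-shift-vanish _ c₂ ≗-refl))
  coeffXY-unfold₂ c₁ c₂ c₃ (suc a) (suc b) = begin
    ΣS (suc (suc b)) (cell c₁ c₂ c₃ (suc a) (suc b))
      ≈⟨ ΣS-last (suc b) (cell c₁ c₂ c₃ (suc a) (suc b)) ⟩
    ΣS (suc b) (cell c₁ c₂ c₃ (suc a) (suc b)) ⊕ cell c₁ c₂ c₃ (suc a) (suc b) (suc b)
      ≈⟨ ⊕-cong (ΣS-cong (suc b) (λ k k<1+b → cell-unfold₂ c₁ c₂ c₃ a b k (ℕP.≤-pred k<1+b)))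
                (cell-indep₂ c₁ c₂ (2 + c₂) c₃ (suc a) (suc b) (suc b) (λ _ → ℕP.n∸n≡0 b)) ⟩
    ΣS (suc b) (λ k → C′ k ⊕ shift c₂ (C″ k)) ⊕ C′ (suc b)
      ≈⟨ ⊕-congˡ (C′ (suc b)) (ΣS-distrib-⊕ (suc b) C′ (λ k → shift c₂ (C″ k))) ⟩
    (ΣS (suc b) C′ ⊕ ΣS (suc b) (λ k → shift c₂ (C″ k))) ⊕ C′ (suc b)
      ≈⟨ ⊕-swapʳ (ΣS (suc b) C′) _ (C′ (suc b)) ⟩
    (ΣS (suc b) C′ ⊕ C′ (suc b)) ⊕ ΣS (suc b) (λ k → shift c₂ (C″ k))
      ≈⟨ ⊕-cong (ΣS-last (suc b) C′) (shift-ΣS c₂ (suc b) C″) ⟨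
    coeffXY c₁ (2 + c₂) c₃ (suc a) (suc b) ⊕ shift c₂ (coeffXY (2 + c₁) (4 + c₂) (6 + c₃) a b) ∎
    where
    open ≗-Reasoning
    C′ = cell c₁ (2 + c₂) c₃ (suc a) (suc b)
    C″ = cell (2 + c₁) (4 + c₂) (6 + c₃) a b

  coeffXY-unfold₃ : ∀ c₁ c₂ c₃ a b →
    coeffXY c₁ c₂ c₃ a b
      ≗ (coeffXY c₁ c₂ (6 + c₃) a b
          ⊕ negate (shift c₃ (timesXY 2 1 (coeffXY (6 + c₁) (6 + c₂) (18 + c₃)) a b)))
  coeffXY-unfold₃ c₁ c₂ c₃ zero b =
    ≗-trans (coeffXY-indep₃ c₁ c₂ c₃ (6 + c₃) 0 b n₃≡0) (≗-sym (negate-shift-vanish _ c₃ ≗-refl))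
    where
    n₃≡0 : ∀ k → k ≤ b → b + k ≤ 0 → k ≡ 0
    n₃≡0 k _ b+k≤0 = ℕP.m+n≡0⇒n≡0 b (ℕP.n≤0⇒n≡0 b+k≤0)
  coeffXY-unfold₃ c₁ c₂ c₃ (suc zero) b =
    ≗-trans (coeffXY-indep₃ c₁ c₂ c₃ (6 + c₃) 1 b n₃≡0) (≗-sym (negate-shift-vanish _ c₃ ≗-refl))
    where
    n₃≡0 : ∀ k → k ≤ b → b + k ≤ 1 → k ≡ 0
    n₃≡0 zero    _   _      = refl
    n₃≡0 (suc k) k<b b+k≤1 = ⊥-elim (ℕP.1+n≰n (ℕP.≤-trans (ℕP.+-mono-≤ (ℕP.≤-trans (s≤s z≤n) k<b) (s≤s z≤n)) b+k≤1))
  coeffXY-unfold₃ c₁ c₂ c₃ (suc (suc a)) zero =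
    ≗-trans (coeffXY-indep₃ c₁ c₂ c₃ (6 + c₃) (suc (suc a)) 0 (λ k k≤0 _ → ℕP.n≤0⇒n≡0 k≤0))
            (≗-sym (negate-shift-vanish _ c₃ ≗-refl))
  coeffXY-unfold₃ c₁ c₂ c₃ (suc (suc a)) (suc b) = begin
    C 0 ⊕ ΣS (suc b) (λ j → C (suc j))
      ≈⟨ ⊕-cong (cell-indep₃ c₁ c₂ c₃ (6 + c₃) (suc (suc a)) (suc b) 0 (λ _ → refl))
                (ΣS-cong (suc b) (λ j j<1+b → cell-unfold₃ c₁ c₂ c₃ a b j (ℕP.≤-pred j<1+b))) ⟩
    C′ 0 ⊕ ΣS (suc b) (λ j → C′ (suc j) ⊕ negate (shift c₃ (C‴ j)))
      ≈⟨ ⊕-congʳ (C′ 0) (ΣS-distrib-⊕ (suc b) (λ j → C′ (suc j)) (λ j → negate (shift c₃ (C‴ j)))) ⟩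
    C′ 0 ⊕ (ΣS (suc b) (λ j → C′ (suc j)) ⊕ ΣS (suc b) (λ j → negate (shift c₃ (C‴ j))))
      ≈⟨ ⊕-assoc (C′ 0) (ΣS (suc b) (λ j → C′ (suc j))) _ ⟨
    coeffXY c₁ c₂ (6 + c₃) (suc (suc a)) (suc b) ⊕ ΣS (suc b) (λ j → negate (shift c₃ (C‴ j)))
      ≈⟨ ⊕-congʳ (coeffXY c₁ c₂ (6 + c₃) (suc (suc a)) (suc b))
                 (≗-trans (negate-cong (shift-ΣS c₃ (suc b) C‴))
                          (negate-ΣS (suc b) (λ j → shift c₃ (C‴ j)))) ⟨
    coeffXY c₁ c₂ (6 + c₃) (suc (suc a)) (suc b) ⊕ negate (shift c₃ (coeffXY (6 + c₁) (6 + c₂) (18 + c₃) a b)) ∎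
    where
    open ≗-Reasoning
    C  = cell c₁ c₂ c₃ (suc (suc a)) (suc b)
    C′ = cell c₁ c₂ (6 + c₃) (suc (suc a)) (suc b)
    C‴ = cell (6 + c₁) (6 + c₂) (18 + c₃) a b

  cell-shift6 : ∀ c₁ c₂ c₃ a b k → k ≤ b →
    cell (6 + c₁) (6 + c₂) (12 + c₃) a b k ≗ shift (6 * a) (cell c₁ c₂ c₃ a b k)
  cell-shift6 c₁ c₂ c₃ a b k k≤b with b + k ≤? a
  ... | yes b+k≤a = begin
    cell (6 + c₁) (6 + c₂) (12 + c₃) a b k                 ≈⟨ cell-valid (6 + c₁) (6 + c₂) (12 + c₃) n₁ n₂ eq₂ eq₁ ⟩
    term (6 + c₁) (6 + c₂) (12 + c₃) n₁ n₂ k               ≈⟨ term-shift6 c₁ c₂ c₃ n₁ n₂ k ⟩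
    shift (6 * (n₁ + n₂ + 2 * k)) (term c₁ c₂ c₃ n₁ n₂ k)  ≈⟨ shift-≡ (term c₁ c₂ c₃ n₁ n₂ k) (cong (6 *_) degree) ⟩
    shift (6 * a) (term c₁ c₂ c₃ n₁ n₂ k)                  ≈⟨ shift-cong (6 * a) (cell-valid c₁ c₂ c₃ n₁ n₂ eq₂ eq₁) ⟨
    shift (6 * a) (cell c₁ c₂ c₃ a b k) ∎
    where
    open ≗-Reasoning
    n₁ = a ∸ (b + k)
    n₂ = b ∸ k
    eq₂ : n₂ + k ≡ b
    eq₂ = ℕP.m∸n+n≡m k≤b
    eq₁ : b + k + n₁ ≡ a
    eq₁ = ℕP.m+[n∸m]≡n b+k≤a
    degree : n₁ + n₂ + 2 * k ≡ a
    degree = trans (solve 3 (λ n₁ n₂ k → n₁ :+ n₂ :+ con 2 :* k := n₂ :+ k :+ k :+ n₁) refl n₁ n₂ k)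
                   (trans (cong (λ m → m + k + n₁) eq₂) eq₁)
  ... | no b+k≰a = begin
    cell (6 + c₁) (6 + c₂) (12 + c₃) a b k  ≈⟨ cell-invalid (6 + c₁) (6 + c₂) (12 + c₃) a b k b+k≰a ⟩
    zeroS                                   ≈⟨ shift-zeroS (6 * a) ⟨
    shift (6 * a) zeroS                     ≈⟨ shift-cong (6 * a) (cell-invalid c₁ c₂ c₃ a b k b+k≰a) ⟨
    shift (6 * a) (cell c₁ c₂ c₃ a b k) ∎
    where open ≗-Reasoning

  coeffXY-shift6 : ∀ c₁ c₂ c₃ a b →
    coeffXY (6 + c₁) (6 + c₂) (12 + c₃) a b ≗ shift (6 * a) (coeffXY c₁ c₂ c₃ a b)
  coeffXY-shift6 c₁ c₂ c₃ a b =
    ≗-trans (ΣS-cong (suc b) (λ k k<1+b → cell-shift6 c₁ c₂ c₃ a b k (ℕP.≤-pred k<1+b)))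
            (≗-sym (shift-ΣS (6 * a) (suc b) (cell c₁ c₂ c₃ a b)))

  coeffXY-x⁰y⁰ : ∀ c₁ c₂ c₃ → coeffXY c₁ c₂ c₃ 0 0 ≗ oneS
  coeffXY-x⁰y⁰ c₁ c₂ c₃ = begin
    coeffXY c₁ c₂ c₃ 0 0         ≈⟨ ⊕-identityʳ (cell c₁ c₂ c₃ 0 0 0) ⟩
    cell c₁ c₂ c₃ 0 0 0          ≈⟨ cell-valid c₁ c₂ c₃ {0} {0} {0} 0 0 refl refl ⟩
    term c₁ c₂ c₃ 0 0 0          ≈⟨ term-indep₁ c₁ 0 c₂ c₃ 0 0 0 refl ⟩
    term 0 c₂ c₃ 0 0 0           ≈⟨ term-indep₂ 0 c₂ 0 c₃ 0 0 0 refl ⟩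
    term 0 0 c₃ 0 0 0            ≈⟨ term-indep₃ 0 0 c₃ 0 0 0 0 refl ⟩
    scale 1ℤ (recipDenom 0 0 0)  ≈⟨ (λ n → *-identityˡ (recipDenom 0 0 0 n)) ⟩
    (oneS ⊛ oneS) ⊛ oneS         ≈⟨ ⊛-identityʳ (oneS ⊛ oneS) ⟩
    oneS ⊛ oneS                  ≈⟨ ⊛-identityʳ oneS ⟩
    oneS ∎
    where open ≗-Reasoning

  coeffXY-x⁰ : ∀ c₁ c₂ c₃ b → coeffXY c₁ c₂ c₃ 0 (suc b) ≗ zeroS
  coeffXY-x⁰ c₁ c₂ c₃ b n = Σ<-zero (suc (suc b)) {λ k → cell c₁ c₂ c₃ 0 (suc b) k n} (λ _ _ → refl)

module Recurrences where

  open import Defs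
  open PowerSeries
  open BivariateSeries
  open Coefficients
  open import Data.Nat as ℕ using (ℕ; _<_; _+_)
  open import Data.Nat.Induction using (<-rec)
  open import Data.Nat.Solver using (module +-*-Solver)
  open import Data.Product using (_×_; _,_; proj₁; proj₂)
  open import Function using (_∘_)
  open import Relation.Binary.PropositionalEquality
  open +-*-Solver using (solve; _:+_; _:=_; con)

  -- Each of these follows from coeffXY-unfold₁₋₃ and the other one in lower x-degree.
  Unfold₂₃ Unfold₁₃ : ℕ → Set
  Unfold₂₃ a = ∀ c₁ c₂ c₃ → c₃ ≡ c₁ + c₂ + 2 → ∀ b →
    coeffXY c₁ c₂ c₃ a b
      ≗ (coeffXY c₁ (2 + c₂) (6 + c₃) a b ⊕ shift c₂ (timesXY 1 1 (coeffXY (4 + c₁) (4 + c₂) (12 + c₃)) a b))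
  Unfold₁₃ a = ∀ c₁ c₂ c₃ → c₃ ≡ c₁ + c₂ + 2 → ∀ b →
    coeffXY c₁ c₂ c₃ a b
      ≗ (coeffXY (2 + c₁) c₂ (6 + c₃) a b ⊕ shift c₁ (timesXY 1 0 (coeffXY (4 + c₁) (4 + c₂) (12 + c₃)) a b))

  private
    c₃-shift₂ : ∀ c₁ c₂ c₃ → c₃ ≡ c₁ + c₂ + 2 → 6 + c₃ ≡ 2 + c₁ + (4 + c₂) + 2
    c₃-shift₂ c₁ c₂ c₃ refl = solve 2 (λ c₁ c₂ → con 6 :+ (c₁ :+ c₂ :+ con 2) := con 2 :+ c₁ :+ (con 4 :+ c₂) :+ con 2) refl c₁ c₂

    c₃-shift₁ : ∀ c₁ c₂ c₃ → c₃ ≡ c₁ + c₂ + 2 → 6 + c₃ ≡ 4 + c₁ + (2 + c₂) + 2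
    c₃-shift₁ c₁ c₂ c₃ refl = solve 2 (λ c₁ c₂ → con 6 :+ (c₁ :+ c₂ :+ con 2) := con 4 :+ c₁ :+ (con 2 :+ c₂) :+ con 2) refl c₁ c₂

    exponent₂ : ∀ c₁ c₂ c₃ → c₃ ≡ c₁ + c₂ + 2 → c₂ + (2 + c₁) ≡ c₃
    exponent₂ c₁ c₂ c₃ refl = solve 2 (λ c₁ c₂ → c₂ :+ (con 2 :+ c₁) := c₁ :+ c₂ :+ con 2) refl c₁ c₂

    exponent₁ : ∀ c₁ c₂ c₃ → c₃ ≡ c₁ + c₂ + 2 → c₁ + (2 + c₂) ≡ c₃
    exponent₁ c₁ c₂ c₃ refl = solve 2 (λ c₁ c₂ → c₁ :+ (con 2 :+ c₂) := c₁ :+ c₂ :+ con 2) refl c₁ c₂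

  unfold₂₃-step : ∀ a → (∀ {a′} → a′ < a → Unfold₁₃ a′) → Unfold₂₃ a
  unfold₂₃-step a unfold₁₃ c₁ c₂ c₃ c₃≡ b = begin
    coeffXY c₁ c₂ c₃ a b
      ≈⟨ coeffXY-unfold₂ c₁ c₂ c₃ a b ⟩
    coeffXY c₁ (2 + c₂) c₃ a b ⊕ shift c₂ (timesXY 1 1 (coeffXY (2 + c₁) (4 + c₂) (6 + c₃)) a b)
      ≈⟨ ⊕-cong (coeffXY-unfold₃ c₁ (2 + c₂) c₃ a b)
                (shift-cong c₂ (timesXY-recurrence (shift (2 + c₁)) (shift-zeroS (2 + c₁)) (shift-cong (2 + c₁)) 0 1 1 0 a b
                   (λ a′ a′<a → unfold₁₃ a′<a (2 + c₁) (4 + c₂) (6 + c₃) (c₃-shift₂ c₁ c₂ c₃ c₃≡)))) ⟩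
    (coeffXY c₁ (2 + c₂) (6 + c₃) a b ⊕ negate (shift c₃ (timesXY 2 1 P a b)))
      ⊕ shift c₂ (timesXY 1 1 Q a b ⊕ shift (2 + c₁) (timesXY 2 1 P a b))
      ≈⟨ negate-shift-cancel (coeffXY c₁ (2 + c₂) (6 + c₃) a b) (timesXY 2 1 P a b) (timesXY 1 1 Q a b) c₂ c₃ (2 + c₁) (exponent₂ c₁ c₂ c₃ c₃≡) ⟩
    coeffXY c₁ (2 + c₂) (6 + c₃) a b ⊕ shift c₂ (timesXY 1 1 Q a b) ∎
    where
    open ≗-Reasoning
    P = coeffXY (6 + c₁) (8 + c₂) (18 + c₃)
    Q = coeffXY (4 + c₁) (4 + c₂) (12 + c₃)

  unfold₁₃-step : ∀ a → (∀ {a′} → a′ < a → Unfold₂₃ a′) → Unfold₁₃ a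
  unfold₁₃-step a unfold₂₃ c₁ c₂ c₃ c₃≡ b = begin
    coeffXY c₁ c₂ c₃ a b
      ≈⟨ coeffXY-unfold₁ c₁ c₂ c₃ a b ⟩
    coeffXY (2 + c₁) c₂ c₃ a b ⊕ shift c₁ (timesXY 1 0 (coeffXY (4 + c₁) (2 + c₂) (6 + c₃)) a b)
      ≈⟨ ⊕-cong (coeffXY-unfold₃ (2 + c₁) c₂ c₃ a b)
                (shift-cong c₁ (timesXY-recurrence (shift (2 + c₂)) (shift-zeroS (2 + c₂)) (shift-cong (2 + c₂)) 0 0 1 1 a b
                   (λ a′ a′<a → unfold₂₃ a′<a (4 + c₁) (2 + c₂) (6 + c₃) (c₃-shift₁ c₁ c₂ c₃ c₃≡)))) ⟩
    (coeffXY (2 + c₁) c₂ (6 + c₃) a b ⊕ negate (shift c₃ (timesXY 2 1 P a b)))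
      ⊕ shift c₁ (timesXY 1 0 Q a b ⊕ shift (2 + c₂) (timesXY 2 1 P a b))
      ≈⟨ negate-shift-cancel (coeffXY (2 + c₁) c₂ (6 + c₃) a b) (timesXY 2 1 P a b) (timesXY 1 0 Q a b) c₁ c₃ (2 + c₂) (exponent₁ c₁ c₂ c₃ c₃≡) ⟩
    coeffXY (2 + c₁) c₂ (6 + c₃) a b ⊕ shift c₁ (timesXY 1 0 Q a b) ∎
    where
    open ≗-Reasoning
    P = coeffXY (8 + c₁) (6 + c₂) (18 + c₃)
    Q = coeffXY (4 + c₁) (4 + c₂) (12 + c₃)

  unfolds : ∀ a → Unfold₂₃ a × Unfold₁₃ a
  unfolds = <-rec _ λ a IH → unfold₂₃-step a (proj₂ ∘ IH) , unfold₁₃-step a (proj₁ ∘ IH)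

  coeffXY-unfold₂₃ : ∀ a → Unfold₂₃ a
  coeffXY-unfold₂₃ a = proj₁ (unfolds a)

  coeffXY-unfold₁₃ : ∀ a → Unfold₁₃ a
  coeffXY-unfold₁₃ a = proj₂ (unfolds a)

module Counting where

  open import Data.Nat as ℕ using (ℕ)
  open import Data.Integer using (ℤ; +_; 0ℤ; 1ℤ; _+_)
  open import Data.Fin using (Fin)
  open import Data.Fin.Properties using (+↔⊎; 1↔⊤)
  open import Data.Product using (Σ; _×_; _,_; proj₁)
  open import Data.Product.Properties using (Σ-≡,≡→≡)
  open import Data.Sum using (_⊎_)
  open import Data.Sum.Function.Propositional using (_⊎-↔_)
  open import Data.Unit using (tt)
  open import Data.Empty using (⊥-elim)
  open import Function.Bundles using (_↔_; mk↔ₛ′)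
  open import Function.Properties.Inverse using (↔-trans)
  open import Relation.Nullary using (¬_)
  open import Relation.Nullary.Irrelevant using (Irrelevant)
  open import Relation.Binary.PropositionalEquality

  Counts : Set → ℤ → Set
  Counts X z = Σ ℕ λ c → (Fin c ↔ X) × z ≡ + c

  Counts-↔ : ∀ {X Y z} → X ↔ Y → Counts X z → Counts Y z
  Counts-↔ X↔Y (c , Fin↔X , z≡c) = c , ↔-trans Fin↔X X↔Y , z≡c

  Counts-≡ : ∀ {X z z′} → z ≡ z′ → Counts X z → Counts X z′
  Counts-≡ refl counts = counts

  Counts-⊎ : ∀ {X Y x y} → Counts X x → Counts Y y → Counts (X ⊎ Y) (x + y)
  Counts-⊎ (c , Fin↔X , x≡c) (d , Fin↔Y , y≡d) = c ℕ.+ d , ↔-trans +↔⊎ (Fin↔X ⊎-↔ Fin↔Y) , cong₂ _+_ x≡c y≡d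

  Counts-empty : ∀ {X} → ¬ X → Counts X 0ℤ
  Counts-empty ¬x = 0 , mk↔ₛ′ (λ ()) (λ x → ⊥-elim (¬x x)) (λ x → ⊥-elim (¬x x)) (λ ()) , refl

  Counts-single : ∀ {X} (x : X) → (∀ y → y ≡ x) → Counts X 1ℤ
  Counts-single x unique = 1 , ↔-trans 1↔⊤ (mk↔ₛ′ (λ _ → x) (λ _ → tt) (λ y → sym (unique y)) (λ _ → refl)) , refl

  ×-irrelevant : ∀ {A B : Set} → Irrelevant A → Irrelevant B → Irrelevant (A × B)
  ×-irrelevant irrA irrB (a , b) (a′ , b′) = cong₂ _,_ (irrA a a′) (irrB b b′)

  Σ-≡-irrelevant : ∀ {A : Set} {P : A → Set} → (∀ {x} → Irrelevant (P x)) →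
                   ∀ {u v : Σ A P} → proj₁ u ≡ proj₁ v → u ≡ v
  Σ-≡-irrelevant irrP {_ , p} {_ , q} refl = Σ-≡,≡→≡ (refl , irrP p q)

  Σ-↔ : ∀ {A B : Set} {P : A → Set} {Q : B → Set} →
        (∀ {x} → Irrelevant (P x)) → (∀ {y} → Irrelevant (Q y)) →
        (f : A → B) (g : B → A) → (∀ {x} → P x → Q (f x)) → (∀ {y} → Q y → P (g y)) →
        (∀ {x} → P x → g (f x) ≡ x) → (∀ {y} → Q y → f (g y) ≡ y) →
        Σ A P ↔ Σ B Q
  Σ-↔ irrP irrQ f g P⇒Q Q⇒P gf fg =
    mk↔ₛ′ (λ (x , p) → f x , P⇒Q p) (λ (y , q) → g y , Q⇒P q)
          (λ (y , q) → Σ-≡-irrelevant irrQ (fg q)) (λ (x , p) → Σ-≡-irrelevant irrP (gf p))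

module Partitions where

  open import Defs
  open Counting
  open import Data.Bool using (true; false; if_then_else_)
  open import Data.Nat as ℕ using (ℕ; suc; _∸_; _≤_; _<_; s≤s; _≟_; _%_; _≡ᵇ_; _*_; _+_)
  open import Data.Nat.Properties as ℕP using ()
  open import Data.Nat.ListAction using (sum)
  open import Data.List using (List; []; _∷_; length; map)
  open import Data.List.Properties using (length-map; map-∘; map-id)
  open import Data.Nat.DivMod using ([m+kn]%n≡m%n)
  open import Data.Nat.Solver using (module +-*-Solver)
  open +-*-Solver using (solve; _:+_; _:*_; _:=_; con)
  open import Data.Product using (Σ; _×_; _,_; proj₁)
  open import Data.Empty using (⊥-elim)
  open import Data.Sum using (_⊎_; inj₁; inj₂)
  open import Function using (id)
  open import Function.Bundles using (_↔_; mk↔ₛ′)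
  open import Relation.Nullary using (yes; no; ¬_)
  open import Relation.Nullary.Irrelevant using (Irrelevant)
  open import Relation.Binary.PropositionalEquality

  -- Partitions written in increasing order with smallest part ≥ m: a part k
  -- must be followed by a part ≥ k + gap k.
  data Ascending : ℕ → List ℕ → Set where
    []  : ∀ {m} → Ascending m []
    _∷_ : ∀ {m k l} → m ≤ k → Ascending (k + gap k) l → Ascending m (k ∷ l)

  Ascending-irrelevant : ∀ {m l} → Irrelevant (Ascending m l)
  Ascending-irrelevant []        []        = refl
  Ascending-irrelevant (p ∷ asc) (q ∷ asc′) = cong₂ _∷_ (ℕP.≤-irrelevant p q) (Ascending-irrelevant asc asc′)

  Ascending-weaken : ∀ {m l} → Ascending (suc m) l → Ascending m l
  Ascending-weaken []          = []
  Ascending-weaken (m<k ∷ asc) = ℕP.<⇒≤ m<k ∷ asc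

  HasStats : ℕ → ℕ → ℕ → List ℕ → Set
  HasStats a b N l = length l ≡ a × numEven l ≡ b × sum l ≡ N

  HasStats-irrelevant : ∀ {a b N} l → Irrelevant (HasStats a b N l)
  HasStats-irrelevant _ = ×-irrelevant ℕP.≡-irrelevant (×-irrelevant ℕP.≡-irrelevant ℕP.≡-irrelevant)

  Parts : ℕ → ℕ → ℕ → ℕ → Set
  Parts m a b N = Σ (List ℕ) λ l → Ascending m l × HasStats a b N l

  Headed : ℕ → ℕ → ℕ → ℕ → Set
  Headed m a b N = Σ (List ℕ) λ l → Ascending (m + gap m) l × HasStats a b N (m ∷ l)

  Parts-≡ : ∀ {m a b N} {x y : Parts m a b N} → proj₁ x ≡ proj₁ y → x ≡ y
  Parts-≡ = Σ-≡-irrelevant (λ {l} → ×-irrelevant Ascending-irrelevant (HasStats-irrelevant l))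

  Headed-≡ : ∀ {m a b N} {x y : Headed m a b N} → proj₁ x ≡ proj₁ y → x ≡ y
  Headed-≡ {m} = Σ-≡-irrelevant (λ {l} → ×-irrelevant Ascending-irrelevant (HasStats-irrelevant (m ∷ l)))

  Parts-split : ∀ m a b N → Parts m a b N ↔ (Parts (suc m) a b N ⊎ Headed m a b N)
  Parts-split m a b N = mk↔ₛ′ to from to∘from from∘to
    where
    to : Parts m a b N → Parts (suc m) a b N ⊎ Headed m a b N
    to ([]    , []          , stats) = inj₁ ([] , [] , stats)
    to (k ∷ l , (m≤k ∷ asc) , stats) with m ≟ k
    ... | yes refl = inj₂ (l , asc , stats)
    ... | no m≢k   = inj₁ (k ∷ l , (ℕP.≤∧≢⇒< m≤k m≢k ∷ asc) , stats)
    from : Parts (suc m) a b N ⊎ Headed m a b N → Parts m a b N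
    from (inj₁ (l , asc , stats)) = l , Ascending-weaken asc , stats
    from (inj₂ (l , asc , stats)) = m ∷ l , (ℕP.≤-refl ∷ asc) , stats
    to∘from : ∀ y → to (from y) ≡ y
    to∘from (inj₁ ([]    , []          , stats)) = refl
    to∘from (inj₁ (k ∷ l , (m<k ∷ asc) , stats)) with m ≟ k
    ... | yes refl = ⊥-elim (ℕP.<-irrefl refl m<k)
    ... | no _     = cong inj₁ (Parts-≡ refl)
    to∘from (inj₂ (l , asc , stats)) with m ≟ m
    ... | yes refl = cong inj₂ (Headed-≡ refl)
    ... | no m≢m   = ⊥-elim (m≢m refl)
    from∘to : ∀ x → from (to x) ≡ x
    from∘to ([]    , []          , stats) = refl
    from∘to (k ∷ l , (m≤k ∷ asc) , stats) with m ≟ k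
    ... | yes refl = Parts-≡ refl
    ... | no _     = Parts-≡ refl

  numEven-∷ : ∀ m l → numEven (m ∷ l) ≡ numEven (m ∷ []) + numEven l
  numEven-∷ m l with (m % 2) ≡ᵇ 0
  ... | true  = refl
  ... | false = refl

  numEven-single : ∀ m → numEven (m ∷ []) ≡ (if m % 2 ≡ᵇ 0 then 1 else 0)
  numEven-single m with m % 2 ≡ᵇ 0
  ... | true  = refl
  ... | false = refl

  private
    +-cancel : ∀ k {x n} → k + x ≡ n → x ≡ n ∸ k
    +-cancel k {x} eq = trans (sym (ℕP.m+n∸m≡n k x)) (cong (_∸ k) eq)

    +-uncancel : ∀ k {x n} → k ≤ n → x ≡ n ∸ k → k + x ≡ n
    +-uncancel k k≤n eq = trans (cong (k +_) eq) (ℕP.m+[n∸m]≡n k≤n)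

  Headed↔Parts : ∀ m a b N → numEven (m ∷ []) ≤ b → m ≤ N →
    Headed m (suc a) b N ↔ Parts (m + gap m) a (b ∸ numEven (m ∷ [])) (N ∸ m)
  Headed↔Parts m a b N e≤b m≤N =
    Σ-↔ (λ {l} → ×-irrelevant Ascending-irrelevant (HasStats-irrelevant (m ∷ l)))
        (λ {l} → ×-irrelevant Ascending-irrelevant (HasStats-irrelevant l))
        id id drop add (λ _ → refl) (λ _ → refl)
    where
    e = numEven (m ∷ [])
    drop : ∀ {l} → Ascending (m + gap m) l × HasStats (suc a) b N (m ∷ l) →
           Ascending (m + gap m) l × HasStats a (b ∸ e) (N ∸ m) l
    drop {l} (asc , len , even , total) =
      asc , ℕP.suc-injective len , +-cancel e (trans (sym (numEven-∷ m l)) even) , +-cancel m total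
    add : ∀ {l} → Ascending (m + gap m) l × HasStats a (b ∸ e) (N ∸ m) l →
          Ascending (m + gap m) l × HasStats (suc a) b N (m ∷ l)
    add {l} (asc , len , even , total) =
      asc , cong suc len , trans (numEven-∷ m l) (+-uncancel e e≤b even) , +-uncancel m m≤N total

  gap-6+ : ∀ k → gap (6 + k) ≡ gap k
  gap-6+ k = cong (λ r → if r ≡ᵇ 0 then 4 else 3) (trans (cong (_% 3) (ℕP.+-comm 6 k)) ([m+kn]%n≡m%n k 2 3))

  Ascending-map6 : ∀ {m l} → Ascending m l → Ascending (6 + m) (map (6 +_) l)
  Ascending-map6 []                  = []
  Ascending-map6 {l = k ∷ _} (m≤k ∷ asc) =
    s≤s (s≤s (s≤s (s≤s (s≤s (s≤s m≤k))))) ∷ subst (λ g → Ascending (6 + k + g) _) (sym (gap-6+ k)) (Ascending-map6 asc)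

  Ascending-unmap6 : ∀ {m} l → Ascending (6 + m) (map (6 +_) l) → Ascending m l
  Ascending-unmap6 []      []                                    = []
  Ascending-unmap6 (k ∷ l) (s≤s (s≤s (s≤s (s≤s (s≤s (s≤s m≤k))))) ∷ asc) =
    m≤k ∷ Ascending-unmap6 l (subst (λ g → Ascending (6 + k + g) _) (gap-6+ k) asc)

  unmap6-map6 : ∀ l → map (_∸ 6) (map (6 +_) l) ≡ l
  unmap6-map6 l = trans (sym (map-∘ l)) (map-id l)

  map6-unmap6 : ∀ {m} l → Ascending (6 + m) l → map (6 +_) (map (_∸ 6) l) ≡ l
  map6-unmap6 []      []          = refl
  map6-unmap6 (k ∷ l) (6+m≤k ∷ asc) =
    cong₂ _∷_ (ℕP.m+[n∸m]≡n (ℕP.≤-trans (ℕP.m≤m+n 6 _) 6+m≤k))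
              (map6-unmap6 l (subst (λ n → Ascending n l) k+gap≡6+ asc))
    where
    k+gap≡6+ : k + gap k ≡ 6 + (k + gap k ∸ 6)
    k+gap≡6+ = sym (ℕP.m+[n∸m]≡n (ℕP.≤-trans (ℕP.≤-trans (ℕP.m≤m+n 6 _) 6+m≤k) (ℕP.m≤m+n k (gap k))))

  numEven-map6 : ∀ l → numEven (map (6 +_) l) ≡ numEven l
  numEven-map6 []      = refl
  numEven-map6 (k ∷ l) = begin
    numEven (6 + k ∷ map (6 +_) l)                 ≡⟨ numEven-∷ (6 + k) (map (6 +_) l) ⟩
    numEven (6 + k ∷ []) + numEven (map (6 +_) l)  ≡⟨ cong₂ _+_ single (numEven-map6 l) ⟩
    numEven (k ∷ []) + numEven l                   ≡⟨ numEven-∷ k l ⟨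
    numEven (k ∷ l) ∎
    where
    open ≡-Reasoning
    single : numEven (6 + k ∷ []) ≡ numEven (k ∷ [])
    single = trans (numEven-single (6 + k))
                   (trans (cong (λ r → if r ≡ᵇ 0 then 1 else 0) (trans (cong (_% 2) (ℕP.+-comm 6 k)) ([m+kn]%n≡m%n k 3 2)))
                          (sym (numEven-single k)))

  sum-map6 : ∀ l → sum (map (6 +_) l) ≡ 6 * length l + sum l
  sum-map6 []      = refl
  sum-map6 (k ∷ l) = trans (cong (6 + k +_) (sum-map6 l))
    (solve 3 (λ k n s → con 6 :+ k :+ (con 6 :* n :+ s) := con 6 :* (con 1 :+ n) :+ (k :+ s)) refl k (length l) (sum l))

  Parts-shift6 : ∀ m a b N → 6 * a ≤ N → Parts (6 + m) a b N ↔ Parts m a b (N ∸ 6 * a)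
  Parts-shift6 m a b N 6a≤N =
    Σ-↔ (λ {l} → ×-irrelevant Ascending-irrelevant (HasStats-irrelevant l))
        (λ {l} → ×-irrelevant Ascending-irrelevant (HasStats-irrelevant l))
        (map (_∸ 6)) (map (6 +_)) down up
        (λ (asc , _) → map6-unmap6 _ asc) (λ _ → unmap6-map6 _)
    where
    up : ∀ {l} → Ascending m l × HasStats a b (N ∸ 6 * a) l →
         Ascending (6 + m) (map (6 +_) l) × HasStats a b N (map (6 +_) l)
    up {l} (asc , len , even , total) =
      Ascending-map6 asc , trans (length-map (6 +_) l) len , trans (numEven-map6 l) even ,
      trans (sum-map6 l) (trans (cong₂ (λ n s → 6 * n + s) len total) (ℕP.m+[n∸m]≡n 6a≤N))
    down : ∀ {l} → Ascending (6 + m) l × HasStats a b N l →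
           Ascending m (map (_∸ 6) l) × HasStats a b (N ∸ 6 * a) (map (_∸ 6) l)
    down {l} (asc , len , even , total) =
      Ascending-unmap6 l′ (subst (Ascending (6 + m)) (sym l≡) asc) ,
      trans (length-map (_∸ 6) l) len ,
      trans (sym (numEven-map6 l′)) (trans (cong numEven l≡) even) ,
      trans (sym (ℕP.m+n∸m≡n (6 * a) (sum l′)))
            (cong (_∸ 6 * a) (trans (cong (λ n → 6 * n + sum l′) (sym len′)) (trans (sym (sum-map6 l′)) (trans (cong sum l≡) total))))
      where
      l′ = map (_∸ 6) l
      l≡ : map (6 +_) l′ ≡ l
      l≡ = map6-unmap6 l asc
      len′ : length l′ ≡ a
      len′ = trans (length-map (_∸ 6) l) len

  Parts-shift6-empty : ∀ m a b N → N < 6 * a → ¬ Parts (6 + m) a b N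
  Parts-shift6-empty m a b N N<6a (l , asc , len , _ , total) =
    ℕP.<⇒≱ N<6a (subst (6 * a ≤_) total (subst (λ s → 6 * a ≤ s) sum≡ (ℕP.m≤m+n (6 * a) (sum l′))))
    where
    l′ = map (_∸ 6) l
    sum≡ : 6 * a + sum l′ ≡ sum l
    sum≡ = trans (cong (λ n → 6 * n + sum l′) (sym (trans (length-map (_∸ 6) l) len)))
                 (trans (sym (sum-map6 l′)) (cong sum (map6-unmap6 l asc)))

module Enumeration where

  open import Defs
  open Counting
  open PowerSeries
  open BivariateSeries
  open Coefficients
  open Recurrences
  open Partitions
  open import Data.Nat as ℕ using (ℕ; zero; suc; _∸_; _<_; _≤_; z≤n; s≤s; _*_; _+_; _≤?_)
  open import Data.Nat.Properties as ℕP using ()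
  open import Data.Nat.Induction using (<-rec)
  open import Data.List using ([]; _∷_)
  open import Data.Nat.ListAction using (sum)
  open import Data.Product using (_×_; _,_; proj₁; proj₂)
  open import Function.Properties.Inverse using (↔-sym)
  open import Relation.Nullary using (yes; no)
  open import Relation.Binary.PropositionalEquality

  Counted : ℕ → ℕ → ℕ → ℕ → ℕ → Set
  Counted m c₁ c₂ c₃ N = ∀ a b → Counts (Parts m a b N) (coeffXY c₁ c₂ c₃ a b N)

  count-Headed : ∀ m (H : XYSeries) N →
    (m ≤ N → ∀ a b → Counts (Parts (m + gap m) a b (N ∸ m)) (H a b (N ∸ m))) →
    ∀ a b → Counts (Headed m a b N) (shift m (timesXY 1 (numEven (m ∷ [])) H a b) N)
  count-Headed m H N counted zero b =
    Counts-≡ (sym (shift-zeroS m N)) (Counts-empty λ { (_ , _ , () , _) })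
  count-Headed m H N counted (suc a) b with m ≤? N
  ... | no m≰N =
    Counts-≡ (sym (shift-< m _ (ℕP.≰⇒> m≰N)))
             (Counts-empty λ { (l , _ , _ , _ , total) → m≰N (subst (m ≤_) total (ℕP.m≤m+n m (sum l))) })
  ... | yes m≤N with numEven (m ∷ []) ≤? b
  ...   | yes e≤b =
    Counts-≡ (sym (trans (shift-≤ m _ m≤N) (cong-app (timesXY-y≤ (numEven (m ∷ [])) H a e≤b) (N ∸ m))))
             (Counts-↔ (↔-sym (Headed↔Parts m a b N e≤b m≤N)) (counted m≤N a (b ∸ numEven (m ∷ []))))
  ...   | no e≰b =
    Counts-≡ (sym (trans (shift-≤ m _ m≤N) (cong-app (timesXY-y> (numEven (m ∷ [])) H a (ℕP.≰⇒> e≰b)) (N ∸ m))))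
             (Counts-empty λ { (l , _ , _ , even , _) →
                e≰b (subst (numEven (m ∷ []) ≤_) (trans (sym (numEven-∷ m l)) even) (ℕP.m≤m+n _ (numEven l))) })

  count-unfold : ∀ m N (F G H : XYSeries) →
    (∀ a b → F a b ≗ (G a b ⊕ shift m (timesXY 1 (numEven (m ∷ [])) H a b))) →
    (∀ a b → Counts (Parts (suc m) a b N) (G a b N)) →
    (m ≤ N → ∀ a b → Counts (Parts (m + gap m) a b (N ∸ m)) (H a b (N ∸ m))) →
    ∀ a b → Counts (Parts m a b N) (F a b N)
  count-unfold m N F G H F≗ countG countH a b =
    Counts-≡ (sym (F≗ a b N))
             (Counts-↔ (↔-sym (Parts-split m a b N)) (Counts-⊎ (countG a b) (count-Headed m H N countH a b)))

  count-x⁰ : ∀ m c₁ c₂ c₃ b N → Counts (Parts m 0 b N) (coeffXY c₁ c₂ c₃ 0 b N)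
  count-x⁰ m c₁ c₂ c₃ (suc b) N =
    Counts-≡ (sym (coeffXY-x⁰ c₁ c₂ c₃ b N)) (Counts-empty λ { ([] , _ , _ , () , _) })
  count-x⁰ m c₁ c₂ c₃ zero (suc N) =
    Counts-≡ (sym (coeffXY-x⁰y⁰ c₁ c₂ c₃ (suc N))) (Counts-empty λ { ([] , _ , _ , _ , ()) })
  count-x⁰ m c₁ c₂ c₃ zero zero =
    Counts-≡ (sym (coeffXY-x⁰y⁰ c₁ c₂ c₃ 0))
             (Counts-single ([] , [] , refl , refl , refl) λ { ([] , [] , refl , refl , refl) → refl })

  count-shift6 : ∀ m c₁ c₂ c₃ N → (∀ {N′} → N′ < N → Counted m c₁ c₂ c₃ N′) →
    Counted (6 + m) (6 + c₁) (6 + c₂) (12 + c₃) N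
  count-shift6 m c₁ c₂ c₃ N counted zero    b = count-x⁰ (6 + m) (6 + c₁) (6 + c₂) (12 + c₃) b N
  count-shift6 m c₁ c₂ c₃ N counted (suc a) b with 6 * suc a ≤? N
  ... | yes 6a≤N =
    Counts-≡ (sym (trans (coeffXY-shift6 c₁ c₂ c₃ (suc a) b N) (shift-≤ (6 * suc a) _ 6a≤N)))
             (Counts-↔ (↔-sym (Parts-shift6 m (suc a) b N 6a≤N))
                       (counted (ℕP.∸-monoʳ-< {o = 0} (s≤s z≤n) 6a≤N) (suc a) b))
  ... | no 6a≰N =
    Counts-≡ (sym (trans (coeffXY-shift6 c₁ c₂ c₃ (suc a) b N) (shift-< (6 * suc a) _ (ℕP.≰⇒> 6a≰N))))
             (Counts-empty (Parts-shift6-empty m (suc a) b N (ℕP.≰⇒> 6a≰N)))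

  -- The classes used: smallest part ≥ m for m = 1, …, 8, 10; those for m ≥ 7 are
  -- obtained from m - 6 at smaller weight, so induction on the weight N closes.
  CountedAt : ℕ → Set
  CountedAt N = Counted 1 1 2 9 N × Counted 2 3 2 9 N × Counted 4 5 4 15 N × Counted 5 5 6 15 N

  all-counted : ∀ N → CountedAt N
  all-counted = <-rec CountedAt step
    where
    step : ∀ N → (∀ {N′} → N′ < N → CountedAt N′) → CountedAt N
    step N ih = counted₁ , counted₂ , counted₄ , counted₅
      where
      below : ∀ {m} → 1 ≤ m → m ≤ N → N ∸ m < N
      below 1≤m m≤N = ℕP.∸-monoʳ-< {o = 0} 1≤m m≤N
      counted₇ : ∀ {N′} → N′ ≤ N → Counted 7 7 8 21 N′
      counted₇ {N′} N′≤N = count-shift6 1 1 2 9 N′ (λ N″<N′ → proj₁ (ih (ℕP.<-≤-trans N″<N′ N′≤N)))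
      counted₈ : ∀ {N′} → N′ ≤ N → Counted 8 9 8 21 N′
      counted₈ {N′} N′≤N = count-shift6 2 3 2 9 N′ (λ N″<N′ → proj₁ (proj₂ (ih (ℕP.<-≤-trans N″<N′ N′≤N))))
      counted₁₀ : ∀ {N′} → N′ ≤ N → Counted 10 11 10 27 N′
      counted₁₀ {N′} N′≤N = count-shift6 4 5 4 15 N′ (λ N″<N′ → proj₁ (proj₂ (proj₂ (ih (ℕP.<-≤-trans N″<N′ N′≤N)))))
      counted₆ : Counted 6 7 6 15 N
      counted₆ = count-unfold 6 N (coeffXY 7 6 15) (coeffXY 7 8 21) (coeffXY 11 10 27)
                   (λ a b → coeffXY-unfold₂₃ a 7 6 15 refl b) (counted₇ ℕP.≤-refl) (λ _ → counted₁₀ (ℕP.m∸n≤m N 6))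
      counted₅ : Counted 5 5 6 15 N
      counted₅ = count-unfold 5 N (coeffXY 5 6 15) (coeffXY 7 6 15) (coeffXY 9 8 21)
                   (coeffXY-unfold₁ 5 6 15) counted₆ (λ _ → counted₈ (ℕP.m∸n≤m N 5))
      counted₄ : Counted 4 5 4 15 N
      counted₄ = count-unfold 4 N (coeffXY 5 4 15) (coeffXY 5 6 15) (coeffXY 7 8 21)
                   (coeffXY-unfold₂ 5 4 15) counted₅ (λ _ → counted₇ (ℕP.m∸n≤m N 4))
      counted₃ : Counted 3 3 4 9 N
      counted₃ = count-unfold 3 N (coeffXY 3 4 9) (coeffXY 5 4 15) (coeffXY 7 8 21)
                   (λ a b → coeffXY-unfold₁₃ a 3 4 9 refl b) counted₄ (λ _ → counted₇ (ℕP.m∸n≤m N 3))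
      counted₂ : Counted 2 3 2 9 N
      counted₂ = count-unfold 2 N (coeffXY 3 2 9) (coeffXY 3 4 9) (coeffXY 5 6 15)
                   (coeffXY-unfold₂ 3 2 9) counted₃ (λ 2≤N → proj₂ (proj₂ (proj₂ (ih (below (s≤s z≤n) 2≤N)))))
      counted₁ : Counted 1 1 2 9 N
      counted₁ = count-unfold 1 N (coeffXY 1 2 9) (coeffXY 3 2 9) (coeffXY 5 4 15)
                   (coeffXY-unfold₁ 1 2 9) counted₂ (λ 1≤N → proj₁ (proj₂ (proj₂ (ih (below (s≤s z≤n) 1≤N)))))

module RightHandSide where

  open import Defs
  open FiniteSums
  open PowerSeries
  open Summands
  open Coefficients
  open import Data.Nat as ℕ using (ℕ; suc; _∸_; _<_; _≤_; _≟_; _≤?_; _*_; _+_)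
  open import Data.Nat.Properties as ℕP using ()
  open import Data.Nat.Solver using (module +-*-Solver)
  open import Data.Integer using (ℤ; 0ℤ)
  open import Data.Product using (_×_; _,_; proj₁; proj₂)
  open import Data.Empty using (⊥-elim)
  open import Function using (_∘_)
  open import Relation.Nullary using (Dec; ¬_; yes; no)
  open import Relation.Nullary.Decidable using (_×-dec_)
  open import Relation.Binary.PropositionalEquality
  open +-*-Solver using (solve; _:+_; _:*_; _:=_; con)

  module _ (c₁ c₂ c₃ a b N : ℕ) where

    -- the summand of rhsXY is definitionally select (onDiagonal? n₁ n₂ n₃) (summand …)
    onDiagonal? : ∀ n₁ n₂ n₃ → Dec (n₁ + n₂ + 2 * n₃ ≡ a × n₂ + n₃ ≡ b)
    onDiagonal? n₁ n₂ n₃ = (n₁ + n₂ + 2 * n₃ ≟ a) ×-dec (n₂ + n₃ ≟ b)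

    box : ℕ → ℕ → ℕ → ℤ
    box n₁ n₂ n₃ = select (onDiagonal? n₁ n₂ n₃) (summand c₁ c₂ c₃ n₁ n₂ n₃) N

    box-zeroˣ : ∀ n₁ n₂ n₃ → ¬ (n₁ + n₂ + 2 * n₃ ≡ a) → box n₁ n₂ n₃ ≡ 0ℤ
    box-zeroˣ n₁ n₂ n₃ ≢a = select-no (onDiagonal? n₁ n₂ n₃) (≢a ∘ proj₁) N

    box-zeroʸ : ∀ n₁ n₂ n₃ → ¬ (n₂ + n₃ ≡ b) → box n₁ n₂ n₃ ≡ 0ℤ
    box-zeroʸ n₁ n₂ n₃ ≢b = select-no (onDiagonal? n₁ n₂ n₃) (≢b ∘ proj₂) N

    rhsXY-Σ< : rhsXY c₁ c₂ c₃ a b N ≡ Σ< (suc a) (λ n₁ → Σ< (suc a) (λ n₂ → Σ< (suc a) (λ n₃ → box n₁ n₂ n₃)))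
    rhsXY-Σ< =
      trans (ΣS≤-Σ< a (λ n₁ → ΣS≤ a (λ n₂ → ΣS≤ a (B n₁ n₂))) N)
        (Σ<-cong (suc a) λ n₁ _ → trans (ΣS≤-Σ< a (λ n₂ → ΣS≤ a (B n₁ n₂)) N)
          (Σ<-cong (suc a) λ n₂ _ → ΣS≤-Σ< a (B n₁ n₂) N))
      where
      B : ℕ → ℕ → ℕ → FPS
      B n₁ n₂ n₃ = select (onDiagonal? n₁ n₂ n₃) (summand c₁ c₂ c₃ n₁ n₂ n₃)

    sum-n₂ : ∀ n₁ n₃ → Σ< (suc a) (λ n₂ → box n₁ n₂ n₃) ≡ box n₁ (b ∸ n₃) n₃
    sum-n₂ n₁ n₃ = Σ<-single (suc a) (b ∸ n₃) (λ n₂ → box n₁ n₂ n₃)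
      (λ n₂ n₂≢ → box-zeroʸ n₁ n₂ n₃ (λ n₂+n₃≡b → n₂≢ (trans (sym (ℕP.m+n∸n≡m n₂ n₃)) (cong (_∸ n₃) n₂+n₃≡b))))
      (λ a<n₂ → box-zeroˣ n₁ (b ∸ n₃) n₃ (λ total≡a → ℕP.<⇒≱ a<n₂ (subst (b ∸ n₃ ≤_) total≡a
                            (ℕP.≤-trans (ℕP.m≤n+m (b ∸ n₃) n₁) (ℕP.m≤m+n _ (2 * n₃))))))

    sum-n₁ : ∀ n₃ → Σ< (suc a) (λ n₁ → box n₁ (b ∸ n₃) n₃) ≡ box (a ∸ b ∸ n₃) (b ∸ n₃) n₃
    sum-n₁ n₃ = Σ<-single (suc a) (a ∸ b ∸ n₃) (λ n₁ → box n₁ (b ∸ n₃) n₃) off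
      (λ a<n₁ → ⊥-elim (ℕP.<⇒≱ a<n₁ (ℕP.≤-trans (ℕP.m∸n≤m (a ∸ b) n₃) (ℕP.m∸n≤m a b))))
      where
      off : ∀ n₁ → ¬ n₁ ≡ a ∸ b ∸ n₃ → box n₁ (b ∸ n₃) n₃ ≡ 0ℤ
      off n₁ n₁≢ with b ∸ n₃ + n₃ ≟ b
      ... | no  ≢b = box-zeroʸ n₁ (b ∸ n₃) n₃ ≢b
      ... | yes ≡b = box-zeroˣ n₁ (b ∸ n₃) n₃ λ total≡a → n₁≢ (trans (sym (ℕP.m+n∸m≡n (b + n₃) n₁))
                       (trans (cong (_∸ (b + n₃)) (trans (ℕP.+-comm (b + n₃) n₁) (trans (regroup n₁ ≡b) total≡a)))
                              (sym (ℕP.∸-+-assoc a b n₃))))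
        where
        regroup : ∀ n₁ → b ∸ n₃ + n₃ ≡ b → n₁ + (b + n₃) ≡ n₁ + (b ∸ n₃) + 2 * n₃
        regroup n₁ ≡b = trans (cong (λ m → n₁ + (m + n₃)) (sym ≡b))
                              (solve 3 (λ n₁ m n₃ → n₁ :+ (m :+ n₃ :+ n₃) := n₁ :+ m :+ con 2 :* n₃) refl n₁ (b ∸ n₃) n₃)

    diagonal : ℕ → ℤ
    diagonal n₃ = box (a ∸ b ∸ n₃) (b ∸ n₃) n₃

    diagonal-cell : ∀ k → k ≤ b → diagonal k ≡ cell c₁ c₂ c₃ a b k N
    diagonal-cell k k≤b with b + k ≤? a
    ... | yes b+k≤a =
      trans (select-yes (onDiagonal? (a ∸ b ∸ k) (b ∸ k) k) (degree , ℕP.m∸n+n≡m k≤b) N)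
            (trans (summand≗term c₁ c₂ c₃ (a ∸ b ∸ k) (b ∸ k) k N) (sym (select-yes (b + k ≤? a) b+k≤a N)))
      where
      degree : a ∸ b ∸ k + (b ∸ k) + 2 * k ≡ a
      degree = trans (solve 3 (λ n₁ n₂ k → n₁ :+ n₂ :+ con 2 :* k := n₁ :+ (n₂ :+ k :+ k)) refl (a ∸ b ∸ k) (b ∸ k) k)
                 (trans (cong (λ m → a ∸ b ∸ k + (m + k)) (ℕP.m∸n+n≡m k≤b))
                   (trans (cong (_+ (b + k)) (ℕP.∸-+-assoc a b k)) (ℕP.m∸n+n≡m b+k≤a)))
    ... | no b+k≰a =
      trans (box-zeroˣ (a ∸ b ∸ k) (b ∸ k) k λ total≡a → b+k≰a (subst (b + k ≤_) total≡a (ℕP.≤-reflexive (sym too-big))))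
            (sym (cell-invalid c₁ c₂ c₃ a b k b+k≰a N))
      where
      too-big : a ∸ b ∸ k + (b ∸ k) + 2 * k ≡ b + k
      too-big = trans (cong (λ m → m + (b ∸ k) + 2 * k)
                            (trans (ℕP.∸-+-assoc a b k) (ℕP.m≤n⇒m∸n≡0 (ℕP.<⇒≤ (ℕP.≰⇒> b+k≰a)))))
                      (trans (solve 2 (λ m k → con 0 :+ m :+ con 2 :* k := m :+ k :+ k) refl (b ∸ k) k)
                             (cong (_+ k) (ℕP.m∸n+n≡m k≤b)))

    diagonal-beyond-b : ∀ k → b < k → diagonal k ≡ 0ℤ
    diagonal-beyond-b k b<k = box-zeroʸ (a ∸ b ∸ k) (b ∸ k) k λ eq →
      ℕP.<-irrefl (trans (sym eq) (cong (_+ k) (ℕP.m≤n⇒m∸n≡0 (ℕP.<⇒≤ b<k)))) b<k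

    diagonal-beyond-a : ∀ k → a < k → diagonal k ≡ 0ℤ
    diagonal-beyond-a k a<k with k ≤? b
    ... | yes k≤b = trans (diagonal-cell k k≤b)
                          (cell-invalid c₁ c₂ c₃ a b k (λ b+k≤a → ℕP.<⇒≱ a<k (ℕP.≤-trans (ℕP.m≤n+m k b) b+k≤a)) N)
    ... | no  k≰b = diagonal-beyond-b k (ℕP.≰⇒> k≰b)

    rhsXY≡coeffXY : rhsXY c₁ c₂ c₃ a b N ≡ coeffXY c₁ c₂ c₃ a b N
    rhsXY≡coeffXY = begin
      rhsXY c₁ c₂ c₃ a b N
        ≡⟨ rhsXY-Σ< ⟩
      Σ< (suc a) (λ n₁ → Σ< (suc a) (λ n₂ → Σ< (suc a) (λ n₃ → box n₁ n₂ n₃)))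
        ≡⟨ Σ<-cong (suc a) (λ n₁ _ → Σ<-comm (suc a) (suc a) (box n₁)) ⟩
      Σ< (suc a) (λ n₁ → Σ< (suc a) (λ n₃ → Σ< (suc a) (λ n₂ → box n₁ n₂ n₃)))
        ≡⟨ Σ<-comm (suc a) (suc a) (λ n₁ n₃ → Σ< (suc a) (λ n₂ → box n₁ n₂ n₃)) ⟩
      Σ< (suc a) (λ n₃ → Σ< (suc a) (λ n₁ → Σ< (suc a) (λ n₂ → box n₁ n₂ n₃)))
        ≡⟨ Σ<-cong (suc a) (λ n₃ _ → trans (Σ<-cong (suc a) (λ n₁ _ → sum-n₂ n₁ n₃)) (sum-n₁ n₃)) ⟩
      Σ< (suc a) diagonal
        ≡⟨ Σ<-extend (suc a) (suc b) diagonal (λ k a<k → diagonal-beyond-a k a<k) ⟨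
      Σ< (suc a + suc b) diagonal
        ≡⟨ cong (λ m → Σ< m diagonal) (ℕP.+-comm (suc a) (suc b)) ⟩
      Σ< (suc b + suc a) diagonal
        ≡⟨ Σ<-extend (suc b) (suc a) diagonal (λ k b<k → diagonal-beyond-b k b<k) ⟩
      Σ< (suc b) diagonal
        ≡⟨ Σ<-cong (suc b) (λ k k<1+b → diagonal-cell k (ℕP.≤-pred k<1+b)) ⟩
      coeffXY c₁ c₂ c₃ a b N ∎
      where open ≡-Reasoning

module Reversal where

  open import Defs
  open Counting
  open Partitions
  open import Data.Bool using (Bool; true; false; if_then_else_)
  import Data.Bool as Bool
  open import Data.Nat as ℕ using (ℕ; _∸_; _≤_; _%_; _≡ᵇ_; _+_; _≟_)
  open import Data.Nat.Properties as ℕP using ()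
  open import Data.Nat.DivMod using ([m+kn]%n≡m%n)
  open import Data.Nat.ListAction.Properties using (sum-↭)
  open import Data.List using (List; []; _∷_; reverse; _ʳ++_; last)
  open import Data.List.Properties using (reverse-involutive)
  open import Data.List.Relation.Binary.Permutation.Propositional using (_↭_; ↭-sym)
  open import Data.List.Relation.Binary.Permutation.Propositional.Properties using (↭-reverse; ↭-length; filter-↭)
  open import Data.Maybe using (just; nothing)
  open import Data.Product using (_×_; _,_; proj₁; proj₂)
  open import Data.Unit using (⊤; tt)
  open import Function using (_∘_)
  open import Function.Bundles using (_↔_; _⇔_; Equivalence)
  open import Relation.Nullary using (yes; no)
  open import Relation.Nullary.Irrelevant using (Irrelevant)
  open import Axiom.UniquenessOfIdentityProofs using (module Decidable⇒UIP)
  open import Relation.Binary.PropositionalEquality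

  gap-+3 : ∀ n → gap (n + 3) ≡ gap n
  gap-+3 n = cong (λ r → if r ≡ᵇ 0 then 4 else 3) ([m+kn]%n≡m%n n 1 3)

  gap-bounds : ∀ n → 3 ≤ gap n × gap n ≤ 4
  gap-bounds n with n % 3 ≡ᵇ 0
  ... | true  = ℕP.m≤n⇒m≤1+n ℕP.≤-refl , ℕP.≤-refl
  ... | false = ℕP.≤-refl , ℕP.m≤n⇒m≤1+n ℕP.≤-refl

  gap-shift : ∀ n d → gap n ≤ d → gap (n + d) ≤ d
  gap-shift n d gap≤d with d ≟ 3
  ... | yes refl = subst (_≤ 3) (sym (gap-+3 n)) gap≤d
  ... | no  d≢3  = ℕP.≤-trans (proj₂ (gap-bounds (n + d)))
                             (ℕP.≤∧≢⇒< (ℕP.≤-trans (proj₁ (gap-bounds n)) gap≤d) (d≢3 ∘ sym))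

  gap-unshift : ∀ n d → gap (n + d) ≤ d → gap n ≤ d
  gap-unshift n d gap≤d with d ≟ 3
  ... | yes refl = subst (_≤ 3) (gap-+3 n) gap≤d
  ... | no  d≢3  = ℕP.≤-trans (proj₂ (gap-bounds n))
                             (ℕP.≤∧≢⇒< (ℕP.≤-trans (proj₁ (gap-bounds (n + d))) gap≤d) (d≢3 ∘ sym))

  -- The paper's condition on consecutive parts k > n uses gap k; Ascending uses gap n.
  smaller-gap⇒larger-gap : ∀ n k → n + gap n ≤ k → gap k + n ≤ k
  smaller-gap⇒larger-gap n k bound = subst (λ m → gap m + n ≤ m) k≡ (subst (_≤ n + d) (ℕP.+-comm n _) (ℕP.+-monoʳ-≤ n (gap-shift n d gap≤d)))
    where
    d = k ∸ n
    k≡ : n + d ≡ k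
    k≡ = ℕP.m+[n∸m]≡n (ℕP.m+n≤o⇒m≤o n bound)
    gap≤d : gap n ≤ d
    gap≤d = ℕP.+-cancelˡ-≤ n _ _ (subst (n + gap n ≤_) (sym k≡) bound)

  larger-gap⇒smaller-gap : ∀ n k → gap k + n ≤ k → n + gap n ≤ k
  larger-gap⇒smaller-gap n k bound = subst (n + gap n ≤_) k≡ (ℕP.+-monoʳ-≤ n (gap-unshift n d gap≤d))
    where
    d = k ∸ n
    k≡ : n + d ≡ k
    k≡ = ℕP.m+[n∸m]≡n (ℕP.m+n≤o⇒n≤o (gap k) bound)
    gap≤d : gap (n + d) ≤ d
    gap≤d = ℕP.+-cancelˡ-≤ n _ _ (subst (λ m → n + gap m ≤ m) (sym k≡) (subst (_≤ k) (ℕP.+-comm (gap k) n) bound))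

  -- least value allowed for the next part of an Ascending list continuing l reversed
  top : ℕ → List ℕ → ℕ
  top m []      = m
  top m (n ∷ _) = n + gap n

  Descending : ℕ → List ℕ → Set
  Descending m []      = ⊤
  Descending m (k ∷ l) = top m l ≤ k × Descending m l

  Ascending-ʳ++ : ∀ {m} l acc → Ascending m (l ʳ++ acc) → Descending m l × Ascending (top m l) acc
  Ascending-ʳ++ []      acc asc = tt , asc
  Ascending-ʳ++ (k ∷ l) acc asc with Ascending-ʳ++ l (k ∷ acc) asc
  ... | desc , (bound ∷ asc′) = (bound , desc) , asc′

  ʳ++-Ascending : ∀ {m} l acc → Descending m l → Ascending (top m l) acc → Ascending m (l ʳ++ acc)
  ʳ++-Ascending []      acc tt             asc = asc
  ʳ++-Ascending (k ∷ l) acc (bound , desc) asc = ʳ++-Ascending l (k ∷ acc) desc (bound ∷ asc)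

  HasStats-↭ : ∀ {a b N xs ys} → xs ↭ ys → HasStats a b N xs → HasStats a b N ys
  HasStats-↭ xs↭ys (len , even , total) =
    trans (sym (↭-length xs↭ys)) len ,
    trans (sym (↭-length (filter-↭ (λ m → m % 2 ≟ 0) xs↭ys))) even ,
    trans (sym (sum-↭ xs↭ys)) total

  IsS-irrelevant : ∀ {l} → Irrelevant (IsS l)
  IsS-irrelevant nil         nil          = refl
  IsS-irrelevant (one p)     (one q)      = cong one (ℕP.≤-irrelevant p q)
  IsS-irrelevant (cons p x)  (cons q y)   = cong₂ cons (ℕP.≤-irrelevant p q) (IsS-irrelevant x y)

  SmallestNotIn-irrelevant : ∀ T l → Irrelevant (SmallestNotIn T l)
  SmallestNotIn-irrelevant T l with last l
  ... | nothing = λ { tt tt → refl }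
  ... | just m  = Decidable⇒UIP.≡-irrelevant Bool._≟_

  SmallestBound : List ℕ → ℕ → Set
  SmallestBound T k = ∀ m → (1 ≤ m × (m ∈ᵇ T) ≡ false) ⇔ k ≤ m

  module _ (T : List ℕ) (k : ℕ) (bound : SmallestBound T k) where

    IsS⇒Descending : ∀ l → IsS l → SmallestNotIn T l → Descending k l
    IsS⇒Descending []          nil             _        = tt
    IsS⇒Descending (m ∷ [])    (one 1≤m)       m∉T      = Equivalence.to (bound m) (1≤m , m∉T) , tt
    IsS⇒Descending (m ∷ n ∷ l) (cons bound isS) smallest =
      larger-gap⇒smaller-gap n m bound , IsS⇒Descending (n ∷ l) isS smallest

    Descending⇒IsS : ∀ l → Descending k l → IsS l × SmallestNotIn T l
    Descending⇒IsS []          _                = nil , tt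
    Descending⇒IsS (m ∷ [])    (k≤m , _)        = one (proj₁ (Equivalence.from (bound m) k≤m)) , proj₂ (Equivalence.from (bound m) k≤m)
    Descending⇒IsS (m ∷ n ∷ l) (bound , desc) with Descending⇒IsS (n ∷ l) desc
    ... | isS , smallest = cons (smaller-gap⇒larger-gap n m bound) isS , smallest

    SPart↔Parts : ∀ a b N → SPart T a b N ↔ Parts k a b N
    SPart↔Parts a b N =
      Σ-↔ (λ {l} → ×-irrelevant IsS-irrelevant (×-irrelevant (SmallestNotIn-irrelevant T l) (HasStats-irrelevant l)))
          (λ {l} → ×-irrelevant Ascending-irrelevant (HasStats-irrelevant l))
          reverse reverse to from (λ _ → reverse-involutive _) (λ _ → reverse-involutive _)
      where
      to : ∀ {l} → IsS l × SmallestNotIn T l × HasStats a b N l → Ascending k (reverse l) × HasStats a b N (reverse l)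
      to {l} (isS , smallest , stats) =
        ʳ++-Ascending l [] (IsS⇒Descending l isS smallest) [] , HasStats-↭ (↭-sym (↭-reverse l)) stats
      from : ∀ {l} → Ascending k l × HasStats a b N l →
             IsS (reverse l) × SmallestNotIn T (reverse l) × HasStats a b N (reverse l)
      from {l} (asc , stats) with Descending⇒IsS (reverse l) (proj₁ (Ascending-ʳ++ (reverse l) [] (subst (Ascending k) (sym (reverse-involutive l)) asc)))
      ... | isS , smallest = isS , smallest , HasStats-↭ (↭-sym (↭-reverse l)) stats

open import Defs
open Counting
open Enumeration
open RightHandSide
open Reversal
open import Data.Nat using (ℕ; zero; suc; z≤n; s≤s)
open import Data.Integer using (+_)
open import Data.List using ([]; _∷_)
open import Data.Fin using (Fin)
open import Data.Product using (Σ; _×_; _,_; proj₁; proj₂)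
open import Function.Bundles using (_↔_; mk⇔)
open import Function.Properties.Inverse using (↔-sym)
open import Relation.Binary.PropositionalEquality

smallest-[] : SmallestBound [] 1
smallest-[] m = mk⇔ proj₁ (λ 1≤m → 1≤m , refl)

smallest-[1] : SmallestBound (1 ∷ []) 2
smallest-[1] zero          = mk⇔ (λ { (() , _) }) (λ ())
smallest-[1] (suc zero)    = mk⇔ (λ { (_ , ()) }) (λ { (s≤s ()) })
smallest-[1] (suc (suc m)) = mk⇔ (λ _ → s≤s (s≤s z≤n)) (λ _ → s≤s z≤n , refl)

smallest-[1,2,3] : SmallestBound (1 ∷ 2 ∷ 3 ∷ []) 4
smallest-[1,2,3] zero                      = mk⇔ (λ { (() , _) }) (λ ())
smallest-[1,2,3] (suc zero)                = mk⇔ (λ { (_ , ()) }) (λ { (s≤s ()) })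
smallest-[1,2,3] (suc (suc zero))          = mk⇔ (λ { (_ , ()) }) (λ { (s≤s (s≤s ())) })
smallest-[1,2,3] (suc (suc (suc zero)))    = mk⇔ (λ { (_ , ()) }) (λ { (s≤s (s≤s (s≤s ()))) })
smallest-[1,2,3] (suc (suc (suc (suc m)))) = mk⇔ (λ _ → s≤s (s≤s (s≤s (s≤s z≤n)))) (λ _ → s≤s z≤n , refl)

SPart-counted : ∀ T k c₁ c₂ c₃ N → SmallestBound T k → Counted k c₁ c₂ c₃ N →
  ∀ a b → Counts (SPart T a b N) (rhsXY c₁ c₂ c₃ a b N)
SPart-counted T k c₁ c₂ c₃ N bound counted a b =
  Counts-↔ (↔-sym (SPart↔Parts T k bound a b N)) (Counts-≡ (sym (rhsXY≡coeffXY c₁ c₂ c₃ a b N)) (counted a b))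

mainTheorem1 : (a b N : ℕ) →
    (Σ ℕ λ c → (Fin c ↔ SPart [] a b N) × rhsXY 1 2 9 a b N ≡ + c)
  × (Σ ℕ λ c → (Fin c ↔ SPart (1 ∷ []) a b N) × rhsXY 3 2 9 a b N ≡ + c)
  × (Σ ℕ λ c → (Fin c ↔ SPart (1 ∷ 2 ∷ 3 ∷ []) a b N) × rhsXY 5 4 15 a b N ≡ + c)
mainTheorem1 a b N =
    SPart-counted []                1 1 2 9  N smallest-[]       (proj₁ (all-counted N)) a b
  , SPart-counted (1 ∷ [])         2 3 2 9  N smallest-[1]      (proj₁ (proj₂ (all-counted N))) a b
  , SPart-counted (1 ∷ 2 ∷ 3 ∷ []) 4 5 4 15 N smallest-[1,2,3] (proj₁ (proj₂ (proj₂ (all-counted N)))) a b
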